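{- Let $k\ge 3$, $n\ge1$, and let $[a_0,\dots,a_{k-1}]$ represent a $k$-gon modulo $n$, with monodromy group $G(a_0,\dots,a_{k-1})$. Let $C$ be the $k\times k$ integer circulant matrix whose $(i,j)$ entry is $a_{(i-j)\bmod k}$ ($0\le i,j\le k-1$), and let $d_1,\dots,d_k$ be the elementary divisors of the Smith Normal Form of $C$ viewed as a matrix over $\mathbb{Z}$. Then $$G(a_0,\dots,a_{k-1})\cong\Big(\bigoplus_{i=1}^k C_{\delta_i}\Big)\rtimes C_k,\qquad \delta_i=\frac{n}{\gcd(d_i,n)},$$ where $C_m$ denotes the cyclic group of order $m$.
   Context: A $k$-tuple of positive integers $[a_0,\dots,a_{k-1}]$ ($k\ge 3$) represents a $k$-gon modulo $n$ if $a_0+\dots+a_{k-1}=(k-2)n$, $a_i<2n$, $a_i\ne n$ for all $i$, and $\gcd(a_0,\dots,a_{k-1},n)=1$. Indices are read modulo $k$. Its monodromy group $G(a_0,\dots,a_{k-1})$ is the group of permutations of the set $\mathbb{Z}/n\mathbb{Z}\times\mathbb{Z}/k\mathbb{Z}$ generated by $\sigma_0(m,i)=(m,i+1)$ and $\sigma_1(m,i)=(m-a_{i-1},i-1)$ (the monodromy group of the dessin on the rational billiards surface of the polygon). The Smith Normal Form of an integer matrix $C$ is a factorization $C=UDV$ with $U,V$ integer matrices of determinant $\pm1$ and $D=\mathrm{diag}(d_1,\dots,d_k)$ with nonnegative $d_i$ and $d_i\mid d_{i+1}$; the $d_i$ are the elementary divisors. Convention: $\gcd(0,n)=n$. -}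

module Defs where

open import Level using (0ℓ)
open import Data.Nat as ℕ using (ℕ; zero; suc; NonZero; _∸_; _<_; _≤_)
open import Data.Nat.DivMod using (_mod_; _/_)
open import Data.Nat.GCD using (gcd; gcd[m,n]≢0)
open import Data.Nat.Divisibility as ℕD using ()
open import Data.Fin as Fin using (Fin; toℕ; punchIn)
open import Data.Integer as ℤ using (ℤ; +_; -_; _-_)
open import Data.Integer.Divisibility as ℤD using ()
open import Data.List as List using (List; []; _∷_; _++_; reverse; map; foldr; tabulate)
open import Data.Nat.ListAction using (sum)
open import Data.Product using (_×_; _,_; Σ; ∃)
open import Data.Sum using (_⊎_; inj₂)
open import Relation.Binary.PropositionalEquality using (_≡_; _≢_)
open import Relation.Nullary using (yes; no)
open import Algebra.Bundles.Raw using (RawGroup)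
open import Algebra.Morphism.Structures using (module GroupMorphisms)

gcdAll : (k n : ℕ) → (Fin k → ℕ) → ℕ
gcdAll k n a = foldr gcd n (tabulate a)

record IsPolygon (k n : ℕ) (a : Fin k → ℕ) : Set where
  field
    positive : ∀ i → 0 < a i
    sumEq    : sum (tabulate a) ≡ (k ∸ 2) ℕ.* n
    lt2n     : ∀ i → a i < 2 ℕ.* n
    neqn     : ∀ i → a i ≢ n
    coprime  : gcdAll k n a ≡ 1

-- Monodromy group: permutations of Z/n × Z/k generated by σ0, σ1

Point : ℕ → ℕ → Set
Point n k = Fin n × Fin k

data Letter : Set where
  s0 s1 s0⁻ s1⁻ : Letter

invL : Letter → Letter
invL s0  = s0⁻
invL s1  = s1⁻
invL s0⁻ = s0
invL s1⁻ = s1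

module _ (k n : ℕ) {{_ : NonZero k}} {{_ : NonZero n}} (a : Fin k → ℕ) where

  subN : ℕ → ℕ → Fin n
  subN x y = (x ℕ.+ (n ∸ toℕ (y mod n))) mod n

  succK predK : Fin k → Fin k
  succK i = (suc (toℕ i)) mod k
  predK i = (toℕ i ℕ.+ (k ∸ 1)) mod k

  letterAct : Letter → Point n k → Point n k
  letterAct s0  (m , i) = m , succK i
  letterAct s1  (m , i) = subN (toℕ m) (a (predK i)) , predK i
  letterAct s0⁻ (m , i) = m , predK i
  letterAct s1⁻ (m , i) = (toℕ m ℕ.+ a i) mod n , succK i

  wordAct : List Letter → Point n k → Point n k
  wordAct []      p = p
  wordAct (x ∷ w) p = letterAct x (wordAct w p)

  -- G(a_0,...,a_{k-1}): words up to equality of the induced permutations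
  Monodromy : RawGroup 0ℓ 0ℓ
  Monodromy = record
    { Carrier = List Letter
    ; _≈_     = λ w v → ∀ p → wordAct w p ≡ wordAct v p
    ; _∙_     = _++_
    ; ε       = []
    ; _⁻¹     = λ w → reverse (map invL w)
    }

Matrix : ℕ → ℕ → Set
Matrix r c = Fin r → Fin c → ℤ

sumℤ : ∀ {m} → (Fin m → ℤ) → ℤ
sumℤ {zero}  f = + 0
sumℤ {suc m} f = f Fin.zero ℤ.+ sumℤ (λ j → f (Fin.suc j))

_⊗_ : ∀ {r m c} → Matrix r m → Matrix m c → Matrix r c
(A ⊗ B) i j = sumℤ (λ l → A i l ℤ.* B l j)

det : ∀ {m} → Matrix m m → ℤ
det {zero}  M = + 1
det {suc m} M = sumℤ (λ j → (sign j ℤ.* M Fin.zero j) ℤ.* det (λ r c → M (Fin.suc r) (punchIn j c)))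
  where
  sign : Fin (suc m) → ℤ
  sign j = (- (+ 1)) ℤ.^ toℕ j

diag : ∀ {m} → (Fin m → ℕ) → Matrix m m
diag d i j with i Fin.≟ j
... | yes _ = + d i
... | no _  = + 0

circulant : (k : ℕ) {{_ : NonZero k}} → (Fin k → ℕ) → Matrix k k
circulant k a i j = + a ((toℕ i ℕ.+ (k ∸ toℕ j)) mod k)

record IsSNF {k : ℕ} (C U : Matrix k k) (d : Fin k → ℕ) (V : Matrix k k) : Set where
  field
    detU    : det U ≡ + 1 ⊎ det U ≡ - (+ 1)
    detV    : det V ≡ + 1 ⊎ det V ≡ - (+ 1)
    divides : ∀ (i j : Fin k) → toℕ j ≡ suc (toℕ i) → d i ℕD.∣ d j
    factor  : ∀ i j → C i j ≡ ((U ⊗ diag d) ⊗ V) i j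

gcdNonZero : ∀ m n → {{_ : NonZero n}} → NonZero (gcd m n)
gcdNonZero m n@(suc _) = ℕ.≢-nonZero (gcd[m,n]≢0 m n (inj₂ (λ ())))

δ : (k n : ℕ) {{_ : NonZero n}} → (Fin k → ℕ) → Fin k → ℕ
δ k n d i = _/_ n (gcd (d i) n) {{gcdNonZero (d i) n}}

_≡[mod_]_ : ℤ → ℕ → ℤ → Set
x ≡[mod m ] y = (+ m) ℤD.∣ (x - y)

-- the abelian group ⊕_i C_{δ_i}, realised as ℤ^k modulo (δ_i)_i
module _ (k : ℕ) (δs : Fin k → ℕ) where

  Vecℤ : Set
  Vecℤ = Fin k → ℤ

  _≈A_ : Vecℤ → Vecℤ → Set
  x ≈A y = ∀ i → x i ≡[mod δs i ] y i

  _+A_ : Vecℤ → Vecℤ → Vecℤ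
  (x +A y) i = x i ℤ.+ y i

  -A_ : Vecℤ → Vecℤ
  (-A x) i = - x i

  -- a homomorphism ℤ → Aut(⊕ C_{δ_i}) killing k, i.e. a homomorphism C_k → Aut(⊕ C_{δ_i})
  record IsCkAction (act : ℤ → Vecℤ → Vecℤ) : Set where
    field
      cong   : ∀ s x y → x ≈A y → act s x ≈A act s y
      additive : ∀ s x y → act s (x +A y) ≈A (act s x +A act s y)
      zeroAct  : ∀ x → act (+ 0) x ≈A x
      compAct  : ∀ s t x → act (s ℤ.+ t) x ≈A act s (act t x)
      periodic : ∀ x → act (+ k) x ≈A x

  Semidirect : (act : ℤ → Vecℤ → Vecℤ) → RawGroup 0ℓ 0ℓ
  Semidirect act = record
    { Carrier = Vecℤ × ℤ
    ; _≈_     = λ { (x , s) (y , t) → x ≈A y × s ≡[mod k ] t }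
    ; _∙_     = λ { (x , s) (y , t) → (x +A act s y) , s ℤ.+ t }
    ; ε       = (λ _ → + 0) , + 0
    ; _⁻¹     = λ { (x , s) → act (- s) (-A x) , - s }
    }

_≅_ : RawGroup 0ℓ 0ℓ → RawGroup 0ℓ 0ℓ → Set
G ≅ H = Σ (RawGroup.Carrier G → RawGroup.Carrier H) (GroupMorphisms.IsGroupIsomorphism G H)

module Submission where

-- The permutations (m, i) ↦ (m + u_i, i) of ℤ/n × ℤ/k realised by words are exactly the translations
-- by the vectors C y (y ∈ ℤᵏ) modulo n: conjugating σ₀⁻¹σ₁⁻¹, the translation by (a_i)_i, by σ₀ʲ gives the
-- translation by the j-th column of the circulant C. As C = U D V with V unimodular, these are the vectors
-- W x with W = U D, and as U is invertible modulo n, W x ≡ 0 (mod n) iff d_i x_i ≡ 0 (mod n) for all i,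
-- i.e. iff x_i ≡ 0 (mod δ_i). So x ↦ W x embeds ⊕ C_{δ_i} as the translation subgroup, σ₀ generates a
-- complement C_k, and conjugation by σ₀ rotates the coordinates; since C commutes with that rotation, it
-- corresponds to z ↦ V P V⁻¹ z on ℤᵏ. The pair (x, s) acts by (m, i) ↦ (m + (W x)_{i+s}, i + s), which is
-- faithful, multiplicative, and realised by a word, so evaluating words is the required isomorphism.

open import Defs
open import Data.Nat using (ℕ; NonZero; _≤_)
open import Data.Fin using (Fin)
open import Data.Integer using (ℤ)
open import Data.Product using (Σ; _×_)

open import Function.Base using (_∘_)
open import Data.Product using (_,_; proj₁; proj₂)
open import Data.Sum using (_⊎_; inj₁; inj₂)
open import Relation.Nullary using (Dec; yes; no; contradiction)
open import Relation.Binary.PropositionalEquality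
  using (_≡_; _≢_; _≗_; refl; sym; trans; cong; cong₂; cong-app; subst; subst₂; module ≡-Reasoning)

open import Data.Nat as ℕ using (zero; suc; s≤s)
import Data.Nat.Properties as ℕ
import Data.Nat.DivMod as ℕ
import Data.Nat.Divisibility as ℕ
open import Data.Nat.DivMod using (_mod_; _/_)
open import Data.Nat.GCD using (gcd; gcd[m,n]∣m; gcd[m,n]∣n)
open import Data.Nat.Coprimality as Coprime using (coprime-/gcd; coprime-divisor)
open import Data.Nat.GeneralisedArithmetic using (fold)
open import Algebra.Properties.CommutativeSemigroup ℕ.*-commutativeSemigroup using (xy∙z≈xz∙y)

open import Data.Fin as Fin using (zero; suc; toℕ; punchIn; punchOut; inject₁; fromℕ; funToFin; finToFun)
import Data.Fin.Properties as Fin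
open import Data.Fin.Properties using (punchIn-punchOut; punchInᵢ≢i; toℕ-inject₁)
open import Data.Vec.Functional using (insertAt)
open import Data.Vec.Functional.Properties using (insertAt-removeAt)
open import Data.List using (List; []; _∷_; _++_; reverse; map; replicate; concat; tabulate)
open import Data.List.Properties using (unfold-reverse)

open import Data.Integer as ℤ using (+_; -_; _+_; _*_; _-_; 0ℤ; 1ℤ; -1ℤ; +[1+_]; -[1+_])
open import Data.Integer.Properties as ℤ
  using (+-identityˡ; +-identityʳ; *-identityˡ; *-identityʳ; *-zeroˡ; *-zeroʳ; +-comm; *-comm; +-assoc; *-assoc;
         *-distribˡ-+; *-distribʳ-+; neg-distrib-+; neg-distribˡ-*; neg-distribʳ-*; neg-involutive;
         +-inverseˡ; +-inverseʳ; pos-+)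
import Data.Integer.DivMod as ℤ
import Data.Integer.Divisibility.Signed as S
open import Data.Integer.Tactic.RingSolver using (solve-∀)
open import Algebra.Properties.Semiring.Sum ℤ.+-*-semiring
  using (sum; sum-cong-≗; ∑-distrib-+; ∑-comm; *-distribˡ-sum; sum-remove; sum-init-last)

open import Algebra.Bundles.Raw using (RawGroup)
open import Algebra.Morphism.Structures using (module GroupMorphisms)

sumℤ≡sum : ∀ {m} (f : Fin m → ℤ) → sumℤ f ≡ sum f
sumℤ≡sum {zero}  f = refl
sumℤ≡sum {suc m} f = cong (_+_ (f zero)) (sumℤ≡sum (f ∘ suc))

sumℤ-cong : ∀ {m} {f g : Fin m → ℤ} → f ≗ g → sumℤ f ≡ sumℤ g
sumℤ-cong {zero}  f≗g = refl
sumℤ-cong {suc m} f≗g = cong₂ _+_ (f≗g zero) (sumℤ-cong (f≗g ∘ suc))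

sumℤ-distrib-+ : ∀ {m} (f g : Fin m → ℤ) → sumℤ (λ j → f j + g j) ≡ sumℤ f + sumℤ g
sumℤ-distrib-+ f g = begin
  sumℤ (λ j → f j + g j) ≡⟨ sumℤ≡sum (λ j → f j + g j) ⟩
  sum (λ j → f j + g j)  ≡⟨ ∑-distrib-+ f g ⟩
  sum f + sum g          ≡⟨ cong₂ _+_ (sumℤ≡sum f) (sumℤ≡sum g) ⟨
  sumℤ f + sumℤ g        ∎
  where open ≡-Reasoning

*-distribˡ-sumℤ : ∀ {m} c (f : Fin m → ℤ) → c * sumℤ f ≡ sumℤ (λ j → c * f j)
*-distribˡ-sumℤ c f = begin
  c * sumℤ f             ≡⟨ cong (c *_) (sumℤ≡sum f) ⟩
  c * sum f              ≡⟨ *-distribˡ-sum c f ⟩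
  sum (λ j → c * f j)    ≡⟨ sumℤ≡sum (λ j → c * f j) ⟨
  sumℤ (λ j → c * f j)   ∎
  where open ≡-Reasoning

*-distribʳ-sumℤ : ∀ {m} c (f : Fin m → ℤ) → sumℤ f * c ≡ sumℤ (λ j → f j * c)
*-distribʳ-sumℤ c f = trans (*-comm (sumℤ f) c)
  (trans (*-distribˡ-sumℤ c f) (sumℤ-cong (λ j → *-comm c (f j))))

sumℤ-comm : ∀ {m p} (f : Fin m → Fin p → ℤ) →
  sumℤ (λ i → sumℤ (f i)) ≡ sumℤ (λ j → sumℤ (λ i → f i j))
sumℤ-comm f = begin
  sumℤ (λ i → sumℤ (f i))          ≡⟨ trans (sumℤ≡sum (λ i → sumℤ (f i))) (sum-cong-≗ (sumℤ≡sum ∘ f)) ⟩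
  sum (λ i → sum (f i))            ≡⟨ ∑-comm f ⟩
  sum (λ j → sum (λ i → f i j))    ≡⟨ trans (sumℤ≡sum (λ j → sumℤ (λ i → f i j))) (sum-cong-≗ (λ j → sumℤ≡sum (λ i → f i j))) ⟨
  sumℤ (λ j → sumℤ (λ i → f i j))  ∎
  where open ≡-Reasoning

sumℤ-zero : ∀ m → sumℤ {m} (λ _ → 0ℤ) ≡ 0ℤ
sumℤ-zero zero    = refl
sumℤ-zero (suc m) = trans (+-identityˡ _) (sumℤ-zero m)

sumℤ-neg : ∀ {m} (f : Fin m → ℤ) → sumℤ (λ j → - f j) ≡ - sumℤ f
sumℤ-neg {zero}  f = refl
sumℤ-neg {suc m} f = trans (cong (_+_ (- f zero)) (sumℤ-neg (f ∘ suc))) (sym (neg-distrib-+ (f zero) _))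

sumℤ-punchIn : ∀ {m} (i : Fin (suc m)) (f : Fin (suc m) → ℤ) → sumℤ f ≡ f i + sumℤ (f ∘ punchIn i)
sumℤ-punchIn i f = begin
  sumℤ f                     ≡⟨ sumℤ≡sum f ⟩
  sum f                      ≡⟨ sum-remove {i = i} f ⟩
  f i + sum (f ∘ punchIn i)  ≡⟨ cong (_+_ (f i)) (sumℤ≡sum (f ∘ punchIn i)) ⟨
  f i + sumℤ (f ∘ punchIn i) ∎
  where open ≡-Reasoning

sumℤ-single : ∀ {m} (i : Fin (suc m)) (f : Fin (suc m) → ℤ) → (∀ l → f (punchIn i l) ≡ 0ℤ) → sumℤ f ≡ f i
sumℤ-single {m} i f f≡0 =
  trans (sumℤ-punchIn i f) (trans (cong (_+_ (f i)) (trans (sumℤ-cong f≡0) (sumℤ-zero m))) (+-identityʳ (f i)))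

sumℤ-init-last : ∀ {m} (f : Fin (suc m) → ℤ) → sumℤ f ≡ sumℤ (f ∘ inject₁) + f (fromℕ m)
sumℤ-init-last f = trans (sumℤ≡sum f) (trans (sum-init-last f) (cong (_+ f (fromℕ _)) (sym (sumℤ≡sum (f ∘ inject₁)))))

-- Determinants, the adjugate and inverses of unimodular matrices

sign : ∀ {m} → Fin m → ℤ
sign j = (- 1ℤ) ℤ.^ toℕ j

sign-suc : ∀ {m} (j : Fin m) → sign (suc j) ≡ - sign j
sign-suc j = ℤ.-1*i≡-i (sign j)

det-cong : ∀ {m} {M N : Matrix m m} → (∀ i j → M i j ≡ N i j) → det M ≡ det N
det-cong {zero}  M≡N = refl
det-cong {suc m} M≡N = sumℤ-cong λ j →
  cong₂ _*_ (cong (sign j *_) (M≡N zero j)) (det-cong (λ r c → M≡N (suc r) (punchIn j c)))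

-- For x ≢ y, punchIn₂ x y enumerates the indices other than x and y.
punchIn₂ : ∀ {m} → Fin (2 ℕ.+ m) → Fin (2 ℕ.+ m) → Fin m → Fin (2 ℕ.+ m)
punchIn₂ zero    zero    c = suc (suc c)
punchIn₂ zero    (suc y) c = suc (punchIn y c)
punchIn₂ (suc x) zero    c = suc (punchIn x c)
punchIn₂ {suc m} (suc x) (suc y) zero    = zero
punchIn₂ {suc m} (suc x) (suc y) (suc c) = suc (punchIn₂ x y c)

punchIn-punchIn : ∀ {m} (j : Fin (2 ℕ.+ m)) (l : Fin (suc m)) (c : Fin m) →
  punchIn j (punchIn l c) ≡ punchIn₂ j (punchIn j l) c
punchIn-punchIn zero    l       c       = refl
punchIn-punchIn (suc j) zero    c       = refl
punchIn-punchIn {suc m} (suc j) (suc l) zero    = refl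
punchIn-punchIn {suc m} (suc j) (suc l) (suc c) = cong suc (punchIn-punchIn j l c)

punchIn₂-comm : ∀ {m} (x y : Fin (2 ℕ.+ m)) (c : Fin m) → punchIn₂ x y c ≡ punchIn₂ y x c
punchIn₂-comm zero    zero    c = refl
punchIn₂-comm zero    (suc y) c = refl
punchIn₂-comm (suc x) zero    c = refl
punchIn₂-comm {suc m} (suc x) (suc y) zero    = refl
punchIn₂-comm {suc m} (suc x) (suc y) (suc c) = cong suc (punchIn₂-comm x y c)

-- The sign of the term M₀ₓ M₁ᵧ in the expansion of det M along its first two rows.
sign₂ : ∀ {m} → Fin (2 ℕ.+ m) → Fin (2 ℕ.+ m) → ℤ
sign₂ zero    zero    = 0ℤ
sign₂ zero    (suc y) = sign y
sign₂ (suc x) zero    = - sign x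
sign₂ {zero}  (suc x) (suc y) = 0ℤ
sign₂ {suc m} (suc x) (suc y) = sign₂ x y

sign-punchIn : ∀ {m} (j : Fin (2 ℕ.+ m)) (l : Fin (suc m)) → sign j * sign l ≡ sign₂ j (punchIn j l)
sign-punchIn zero    l    = *-identityˡ (sign l)
sign-punchIn (suc j) zero = trans (*-identityʳ (sign (suc j))) (sign-suc j)
sign-punchIn {suc m} (suc j) (suc l) = begin
  sign (suc j) * sign (suc l) ≡⟨ cong₂ _*_ (sign-suc j) (sign-suc l) ⟩
  - sign j * - sign l         ≡⟨ neg-*-neg (sign j) (sign l) ⟩
  sign j * sign l             ≡⟨ sign-punchIn j l ⟩
  sign₂ (suc j) (suc (punchIn j l)) ∎
  where
  open ≡-Reasoning
  neg-*-neg : ∀ a b → - a * - b ≡ a * b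
  neg-*-neg = solve-∀

sign₂-antisym : ∀ {m} (x y : Fin (2 ℕ.+ m)) → sign₂ y x ≡ - sign₂ x y
sign₂-antisym zero    zero    = refl
sign₂-antisym zero    (suc y) = refl
sign₂-antisym (suc x) zero    = sym (neg-involutive (sign x))
sign₂-antisym {zero}  (suc x) (suc y) = refl
sign₂-antisym {suc m} (suc x) (suc y) = sign₂-antisym x y

sign₂-diag : ∀ {m} (x : Fin (2 ℕ.+ m)) → sign₂ x x ≡ 0ℤ
sign₂-diag zero = refl
sign₂-diag {zero}  (suc x) = refl
sign₂-diag {suc m} (suc x) = sign₂-diag x

module _ {m : ℕ} where

  expand₂ : Matrix (2 ℕ.+ m) (2 ℕ.+ m) → Fin (2 ℕ.+ m) → Fin (2 ℕ.+ m) → ℤ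
  expand₂ M x y = sign₂ x y * M zero x * M (suc zero) y * det (λ r c → M (suc (suc r)) (punchIn₂ x y c))

  det-expand₂ : (M : Matrix (2 ℕ.+ m) (2 ℕ.+ m)) → det M ≡ sumℤ (λ x → sumℤ (expand₂ M x))
  det-expand₂ M = sumℤ-cong row₀-term
    where
    minor₂ : Fin (2 ℕ.+ m) → Fin (suc m) → Matrix m m
    minor₂ j l r c = M (suc (suc r)) (punchIn j (punchIn l c))

    regroup : ∀ a b c d e → (a * c) * ((b * d) * e) ≡ a * b * c * d * e
    regroup = solve-∀

    term-punchIn : ∀ j l → (sign j * M zero j) * ((sign l * M (suc zero) (punchIn j l)) * det (minor₂ j l))
                           ≡ expand₂ M j (punchIn j l)
    term-punchIn j l = begin
      (sign j * M zero j) * ((sign l * M (suc zero) (punchIn j l)) * det (minor₂ j l))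
        ≡⟨ regroup (sign j) (sign l) (M zero j) (M (suc zero) (punchIn j l)) (det (minor₂ j l)) ⟩
      sign j * sign l * M zero j * M (suc zero) (punchIn j l) * det (minor₂ j l)
        ≡⟨ cong₂ (λ s D → s * M zero j * M (suc zero) (punchIn j l) * D)
                 (sign-punchIn j l) (det-cong (λ r c → cong (M (suc (suc r))) (punchIn-punchIn j l c))) ⟩
      expand₂ M j (punchIn j l) ∎
      where open ≡-Reasoning

    term-diag : ∀ j → expand₂ M j j ≡ 0ℤ
    term-diag j = begin
      sign₂ j j * M zero j * M (suc zero) j * D  ≡⟨ cong (λ s → s * M zero j * M (suc zero) j * D) (sign₂-diag j) ⟩
      0ℤ * M zero j * M (suc zero) j * D         ≡⟨ zero-product (M zero j) (M (suc zero) j) D ⟩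
      0ℤ ∎
      where
      open ≡-Reasoning
      D = det (λ r c → M (suc (suc r)) (punchIn₂ j j c))
      zero-product : ∀ a b c → 0ℤ * a * b * c ≡ 0ℤ
      zero-product = solve-∀

    row₀-term : ∀ j → (sign j * M zero j) * det (λ r c → M (suc r) (punchIn j c)) ≡ sumℤ (expand₂ M j)
    row₀-term j = begin
      (sign j * M zero j) * det (λ r c → M (suc r) (punchIn j c))
        ≡⟨ *-distribˡ-sumℤ (sign j * M zero j) (λ l → (sign l * M (suc zero) (punchIn j l)) * det (minor₂ j l)) ⟩
      sumℤ (λ l → (sign j * M zero j) * ((sign l * M (suc zero) (punchIn j l)) * det (minor₂ j l)))
        ≡⟨ sumℤ-cong (term-punchIn j) ⟩
      sumℤ (expand₂ M j ∘ punchIn j)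
        ≡⟨ +-identityˡ _ ⟨
      0ℤ + sumℤ (expand₂ M j ∘ punchIn j)
        ≡⟨ cong (_+ sumℤ (expand₂ M j ∘ punchIn j)) (term-diag j) ⟨
      expand₂ M j j + sumℤ (expand₂ M j ∘ punchIn j)
        ≡⟨ sumℤ-punchIn j (expand₂ M j) ⟨
      sumℤ (expand₂ M j) ∎
      where open ≡-Reasoning

swap₀₁ : ∀ {m} → Fin (2 ℕ.+ m) → Fin (2 ℕ.+ m)
swap₀₁ zero          = suc zero
swap₀₁ (suc zero)    = zero
swap₀₁ (suc (suc r)) = suc (suc r)

det-swap₀₁ : ∀ {m} (M : Matrix (2 ℕ.+ m) (2 ℕ.+ m)) → det (M ∘ swap₀₁) ≡ - det M
det-swap₀₁ M = begin
  det (M ∘ swap₀₁)                                ≡⟨ det-expand₂ (M ∘ swap₀₁) ⟩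
  sumℤ (λ x → sumℤ (expand₂ (M ∘ swap₀₁) x))      ≡⟨ sumℤ-cong (λ x → sumℤ-cong (expand₂-swap x)) ⟩
  sumℤ (λ x → sumℤ (λ y → - expand₂ M y x))       ≡⟨ sumℤ-cong (λ x → sumℤ-neg (λ y → expand₂ M y x)) ⟩
  sumℤ (λ x → - sumℤ (λ y → expand₂ M y x))       ≡⟨ sumℤ-neg (λ x → sumℤ (λ y → expand₂ M y x)) ⟩
  - sumℤ (λ x → sumℤ (λ y → expand₂ M y x))       ≡⟨ cong -_ (sumℤ-comm (λ x y → expand₂ M y x)) ⟩
  - sumℤ (λ y → sumℤ (expand₂ M y))               ≡⟨ cong -_ (det-expand₂ M) ⟨
  - det M ∎
  where
  open ≡-Reasoning
  reorder : ∀ s a b d → - s * a * b * d ≡ - (s * b * a * d)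
  reorder = solve-∀
  expand₂-swap : ∀ x y → expand₂ (M ∘ swap₀₁) x y ≡ - expand₂ M y x
  expand₂-swap x y = trans
    (cong₂ (λ s D → s * M (suc zero) x * M zero y * D) (sign₂-antisym y x)
           (det-cong (λ r c → cong (M (suc (suc r))) (punchIn₂-comm x y c))))
    (reorder (sign₂ y x) (M (suc zero) x) (M zero y) _)

x≡-x⇒x≡0 : ∀ x → x ≡ - x → x ≡ 0ℤ
x≡-x⇒x≡0 (+ zero) _ = refl
x≡-x⇒x≡0 +[1+ n ] ()
x≡-x⇒x≡0 -[1+ n ] ()

det-equalRows₀₁ : ∀ {m} (M : Matrix (2 ℕ.+ m) (2 ℕ.+ m)) → M zero ≡ M (suc zero) → det M ≡ 0ℤ
det-equalRows₀₁ M M₀≡M₁ = x≡-x⇒x≡0 (det M) (trans (det-cong M≗M∘swap₀₁) (det-swap₀₁ M))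
  where
  M≗M∘swap₀₁ : ∀ r c → M r c ≡ M (swap₀₁ r) c
  M≗M∘swap₀₁ zero          c = cong-app M₀≡M₁ c
  M≗M∘swap₀₁ (suc zero)    c = cong-app (sym M₀≡M₁) c
  M≗M∘swap₀₁ (suc (suc r)) c = refl

insertAt-map : ∀ {A B : Set} {m} (f : A → B) (xs : Fin m → A) (i : Fin (suc m)) (v : A) →
  f ∘ insertAt xs i v ≗ insertAt (f ∘ xs) i (f v)
insertAt-map f xs zero    v zero    = refl
insertAt-map f xs zero    v (suc r) = refl
insertAt-map {m = suc m} f xs (suc i) v zero    = refl
insertAt-map {m = suc m} f xs (suc i) v (suc r) = insertAt-map f (xs ∘ suc) i v r

-- Expand along the first row and induct; the top two rows then come out in swapped order.
det-insertAt : ∀ {m} (N : Fin m → Fin (suc m) → ℤ) (c : Fin (suc m)) (x : Fin (suc m) → ℤ) →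
  det (insertAt N c x) ≡ sign c * det (insertAt N zero x)
det-insertAt N zero x = sym (*-identityˡ _)
det-insertAt {suc m} N (suc c) x = begin
  sumℤ (λ j → (sign j * N zero j) * det (λ r col → insertAt (N ∘ suc) c x r (punchIn j col)))
    ≡⟨ sumℤ-cong (λ j → cong ((sign j * N zero j) *_) (trans (det-cong (λ r → cong-app (insertAt-map (_∘ punchIn j) (N ∘ suc) c x r)))
                                                              (det-insertAt (N' j) c (x ∘ punchIn j)))) ⟩
  sumℤ (λ j → (sign j * N zero j) * (sign c * det (insertAt (N' j) zero (x ∘ punchIn j))))
    ≡⟨ sumℤ-cong (λ j → swap-factor (sign j * N zero j) (sign c) (det (insertAt (N' j) zero (x ∘ punchIn j)))) ⟩
  sumℤ (λ j → sign c * ((sign j * N zero j) * det (insertAt (N' j) zero (x ∘ punchIn j))))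
    ≡⟨ *-distribˡ-sumℤ (sign c) (λ j → (sign j * N zero j) * det (insertAt (N' j) zero (x ∘ punchIn j))) ⟨
  sign c * det (insertAt N zero x ∘ swap₀₁)
    ≡⟨ cong (sign c *_) (det-swap₀₁ (insertAt N zero x)) ⟩
  sign c * - det (insertAt N zero x)
    ≡⟨ trans (sym (neg-distribʳ-* (sign c) (det (insertAt N zero x)))) (neg-distribˡ-* (sign c) (det (insertAt N zero x))) ⟩
  - sign c * det (insertAt N zero x)
    ≡⟨ cong (_* det (insertAt N zero x)) (sign-suc c) ⟨
  sign (suc c) * det (insertAt N zero x) ∎
  where
  open ≡-Reasoning
  N' : Fin (2 ℕ.+ m) → Fin m → Fin (suc m) → ℤ
  N' j r = N (suc r) ∘ punchIn j
  swap-factor : ∀ a b c → a * (b * c) ≡ b * (a * c)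
  swap-factor = solve-∀

det-insertAt-duplicate : ∀ {m} (N : Fin m → Fin (suc m) → ℤ) (r : Fin m) → det (insertAt N zero (N r)) ≡ 0ℤ
det-insertAt-duplicate {suc m} N r = begin
  det (insertAt N zero (N r))                 ≡⟨ det-cong N≗ ⟩
  det (insertAt (insertAt N' zero (N r)) (suc r) (N r))
    ≡⟨ det-insertAt (insertAt N' zero (N r)) (suc r) (N r) ⟩
  sign (suc r) * det (insertAt (insertAt N' zero (N r)) zero (N r))
    ≡⟨ cong (sign (suc r) *_) (det-equalRows₀₁ (insertAt (insertAt N' zero (N r)) zero (N r)) refl) ⟩
  sign (suc r) * 0ℤ                           ≡⟨ *-zeroʳ (sign (suc r)) ⟩
  0ℤ ∎
  where
  open ≡-Reasoning
  N' = N ∘ punchIn r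
  N≗ : ∀ i j → insertAt N zero (N r) i j ≡ insertAt (insertAt N' zero (N r)) (suc r) (N r) i j
  N≗ zero    j = refl
  N≗ (suc i) j = cong-app (sym (insertAt-removeAt N r i)) j

minor : ∀ {m} → Matrix (suc m) (suc m) → Fin (suc m) → Fin (suc m) → Matrix m m
minor M i j r c = M (punchIn i r) (punchIn j c)

adjugate : ∀ {m} → Matrix (suc m) (suc m) → Matrix (suc m) (suc m)
adjugate M j c = sign c * (sign j * det (minor M c j))

diag-diag : ∀ {m} (d : Fin m → ℕ) (i : Fin m) → diag d i i ≡ + d i
diag-diag d i with i Fin.≟ i
... | yes _  = refl
... | no i≢i = contradiction refl i≢i

diag-offDiag : ∀ {m} (d : Fin m → ℕ) {i j : Fin m} → i ≢ j → diag d i j ≡ 0ℤ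
diag-offDiag d {i} {j} i≢j with i Fin.≟ j
... | yes i≡j = contradiction i≡j i≢j
... | no _    = refl

Id : ∀ {m} → Matrix m m
Id = diag (λ _ → 1)

⊗-adjugate : ∀ {m} (M : Matrix (suc m) (suc m)) r c → (M ⊗ adjugate M) r c ≡ Id r c * det M
⊗-adjugate M r c = trans row-c-replaced (cases r c (r Fin.≟ c))
  where
  regroup : ∀ a s t d → a * (s * (t * d)) ≡ s * ((t * a) * d)
  regroup = solve-∀
  row-c-replaced : (M ⊗ adjugate M) r c ≡ sign c * det (insertAt (M ∘ punchIn c) zero (M r))
  row-c-replaced = trans (sumℤ-cong (λ l → regroup (M r l) (sign c) (sign l) (det (minor M c l))))
                         (sym (*-distribˡ-sumℤ (sign c) (λ l → (sign l * M r l) * det (minor M c l))))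
  cases : ∀ r c → Dec (r ≡ c) → sign c * det (insertAt (M ∘ punchIn c) zero (M r)) ≡ Id r c * det M
  cases r .r (yes refl) = begin
    sign r * det (insertAt (M ∘ punchIn r) zero (M r)) ≡⟨ det-insertAt (M ∘ punchIn r) r (M r) ⟨
    det (insertAt (M ∘ punchIn r) r (M r))             ≡⟨ det-cong (λ i → cong-app (insertAt-removeAt M r i)) ⟩
    det M                                              ≡⟨ *-identityˡ (det M) ⟨
    1ℤ * det M                                         ≡⟨ cong (_* det M) (diag-diag (λ _ → 1) r) ⟨
    Id r r * det M                                     ∎
    where open ≡-Reasoning
  cases r c (no r≢c) = begin
    sign c * det (insertAt (M ∘ punchIn c) zero (M r))
      ≡⟨ cong (λ row → sign c * det (insertAt (M ∘ punchIn c) zero (M row))) (punchIn-punchOut c≢r) ⟨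
    sign c * det (insertAt (M ∘ punchIn c) zero (M (punchIn c (punchOut c≢r))))
      ≡⟨ cong (sign c *_) (det-insertAt-duplicate (M ∘ punchIn c) (punchOut c≢r)) ⟩
    sign c * 0ℤ ≡⟨ *-zeroʳ (sign c) ⟩
    0ℤ          ≡⟨ *-zeroˡ (det M) ⟨
    0ℤ * det M  ≡⟨ cong (_* det M) (diag-offDiag (λ _ → 1) r≢c) ⟨
    Id r c * det M ∎
    where
    open ≡-Reasoning
    c≢r = r≢c ∘ sym

Unimodular : ∀ {m} → Matrix m m → Set
Unimodular M = det M ≡ 1ℤ ⊎ det M ≡ -1ℤ

inverse : ∀ {m} → Matrix (suc m) (suc m) → Matrix (suc m) (suc m)
inverse M j c = det M * adjugate M j c

⊗-inverse : ∀ {m} (M : Matrix (suc m) (suc m)) → Unimodular M → ∀ r c → (M ⊗ inverse M) r c ≡ Id r c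
⊗-inverse M unimodular r c = begin
  sumℤ (λ l → M r l * (det M * adjugate M l c)) ≡⟨ sumℤ-cong (λ l → swap-factor (M r l) (det M) (adjugate M l c)) ⟩
  sumℤ (λ l → det M * (M r l * adjugate M l c)) ≡⟨ *-distribˡ-sumℤ (det M) (λ l → M r l * adjugate M l c) ⟨
  det M * (M ⊗ adjugate M) r c                  ≡⟨ cong (det M *_) (⊗-adjugate M r c) ⟩
  det M * (Id r c * det M)                      ≡⟨ swap-factor (det M) (Id r c) (det M) ⟩
  Id r c * (det M * det M)                      ≡⟨ cong (Id r c *_) (square≡1 unimodular) ⟩
  Id r c * 1ℤ                                   ≡⟨ *-identityʳ (Id r c) ⟩
  Id r c                                        ∎
  where
  open ≡-Reasoning
  swap-factor : ∀ a b c → a * (b * c) ≡ b * (a * c)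
  swap-factor = solve-∀
  square≡1 : ∀ {x} → x ≡ 1ℤ ⊎ x ≡ -1ℤ → x * x ≡ 1ℤ
  square≡1 (inj₁ refl) = refl
  square≡1 (inj₂ refl) = refl

infixr 7 _*ᵛ_
_*ᵛ_ : ∀ {r m} → Matrix r m → (Fin m → ℤ) → Fin r → ℤ
(A *ᵛ x) i = sumℤ (λ l → A i l * x l)

*ᵛ-cong : ∀ {r m} (A : Matrix r m) {x y : Fin m → ℤ} → x ≗ y → A *ᵛ x ≗ A *ᵛ y
*ᵛ-cong A x≗y i = sumℤ-cong (λ l → cong (A i l *_) (x≗y l))

⊗-*ᵛ : ∀ {r m p} (A : Matrix r m) (B : Matrix m p) y → (A ⊗ B) *ᵛ y ≗ A *ᵛ (B *ᵛ y)
⊗-*ᵛ A B y i = begin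
  sumℤ (λ l → sumℤ (λ p → A i p * B p l) * y l)   ≡⟨ sumℤ-cong (λ l → *-distribʳ-sumℤ (y l) (λ p → A i p * B p l)) ⟩
  sumℤ (λ l → sumℤ (λ p → A i p * B p l * y l))   ≡⟨ sumℤ-comm (λ l p → A i p * B p l * y l) ⟩
  sumℤ (λ p → sumℤ (λ l → A i p * B p l * y l))   ≡⟨ sumℤ-cong (λ p → trans (sumℤ-cong (λ l → *-assoc (A i p) (B p l) (y l)))
                                                                           (sym (*-distribˡ-sumℤ (A i p) (λ l → B p l * y l)))) ⟩
  sumℤ (λ p → A i p * sumℤ (λ l → B p l * y l))   ∎
  where open ≡-Reasoning

*ᵛ-distrib-+ : ∀ {r m} (A : Matrix r m) x y → A *ᵛ (λ l → x l + y l) ≗ λ i → (A *ᵛ x) i + (A *ᵛ y) i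
*ᵛ-distrib-+ A x y i = trans (sumℤ-cong (λ l → *-distribˡ-+ (A i l) (x l) (y l)))
                             (sumℤ-distrib-+ (λ l → A i l * x l) (λ l → A i l * y l))

*ᵛ-neg : ∀ {r m} (A : Matrix r m) x → A *ᵛ (λ l → - x l) ≗ λ i → - (A *ᵛ x) i
*ᵛ-neg A x i = trans (sumℤ-cong (λ l → sym (neg-distribʳ-* (A i l) (x l)))) (sumℤ-neg (λ l → A i l * x l))

*ᵛ-zero : ∀ {r m} (A : Matrix r m) → A *ᵛ (λ _ → 0ℤ) ≗ λ _ → 0ℤ
*ᵛ-zero {m = m} A i = trans (sumℤ-cong (λ l → *-zeroʳ (A i l))) (sumℤ-zero m)

diag-*ᵛ : ∀ {m} (d : Fin m → ℕ) x → diag d *ᵛ x ≗ λ i → + d i * x i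
diag-*ᵛ {suc m} d x i = begin
  sumℤ (λ l → diag d i l * x l) ≡⟨ sumℤ-single i (λ l → diag d i l * x l) offDiag ⟩
  diag d i i * x i              ≡⟨ cong (_* x i) (diag-diag d i) ⟩
  + d i * x i                   ∎
  where
  open ≡-Reasoning
  offDiag : ∀ l → diag d i (punchIn i l) * x (punchIn i l) ≡ 0ℤ
  offDiag l = trans (cong (_* x (punchIn i l)) (diag-offDiag d (punchInᵢ≢i i l ∘ sym))) (*-zeroˡ (x (punchIn i l)))

Id-*ᵛ : ∀ {m} x → Id {m} *ᵛ x ≗ x
Id-*ᵛ x i = trans (diag-*ᵛ (λ _ → 1) x i) (*-identityˡ (x i))

*ᵛ-inverse : ∀ {m} (M : Matrix (suc m) (suc m)) → Unimodular M → ∀ z → M *ᵛ (inverse M *ᵛ z) ≗ z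
*ᵛ-inverse M unimodular z i = begin
  (M *ᵛ (inverse M *ᵛ z)) i ≡⟨ ⊗-*ᵛ M (inverse M) z i ⟨
  ((M ⊗ inverse M) *ᵛ z) i  ≡⟨ sumℤ-cong (λ l → cong (_* z l) (⊗-inverse M unimodular i l)) ⟩
  (Id *ᵛ z) i               ≡⟨ Id-*ᵛ z i ⟩
  z i                       ∎
  where open ≡-Reasoning

-- Congruences of integers

-- The signed-divisibility form of _≡[mod_]_, as a record so that x and y are inferable.
infix 4 _≈[_]_
record _≈[_]_ (x : ℤ) (m : ℕ) (y : ℤ) : Set where
  constructor mk≈
  field divides : + m S.∣ x - y
open _≈[_]_

≈-intro : ∀ {m x y} q → x - y ≡ q * + m → x ≈[ m ] y
≈-intro q eq = mk≈ (S.divides q eq)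

module _ {m : ℕ} where

  ≈-refl : ∀ {x} → x ≈[ m ] x
  ≈-refl {x} = ≈-intro 0ℤ (+-inverseʳ x)

  ≈-reflexive : ∀ {x y} → x ≡ y → x ≈[ m ] y
  ≈-reflexive refl = ≈-refl

  ≈-sym : ∀ {x y} → x ≈[ m ] y → y ≈[ m ] x
  ≈-sym {x} {y} (mk≈ (S.divides q eq)) = ≈-intro (- q)
    (trans (flip x y) (trans (cong -_ eq) (neg-distribˡ-* q (+ m))))
    where
    flip : ∀ x y → y - x ≡ - (x - y)
    flip = solve-∀

  ≈-trans : ∀ {x y z} → x ≈[ m ] y → y ≈[ m ] z → x ≈[ m ] z
  ≈-trans {x} {y} {z} (mk≈ (S.divides q eq)) (mk≈ (S.divides r eq′)) = ≈-intro (q + r)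
    (trans (split x y z) (trans (cong₂ _+_ eq eq′) (sym (*-distribʳ-+ (+ m) q r))))
    where
    split : ∀ x y z → x - z ≡ (x - y) + (y - z)
    split = solve-∀

  ≈-+ : ∀ {x x′ y y′} → x ≈[ m ] x′ → y ≈[ m ] y′ → x + y ≈[ m ] x′ + y′
  ≈-+ {x} {x′} {y} {y′} (mk≈ (S.divides q eq)) (mk≈ (S.divides r eq′)) = ≈-intro (q + r)
    (trans (split x x′ y y′) (trans (cong₂ _+_ eq eq′) (sym (*-distribʳ-+ (+ m) q r))))
    where
    split : ∀ x x′ y y′ → (x + y) - (x′ + y′) ≡ (x - x′) + (y - y′)
    split = solve-∀

  ≈-neg : ∀ {x x′} → x ≈[ m ] x′ → - x ≈[ m ] - x′
  ≈-neg {x} {x′} (mk≈ (S.divides q eq)) = ≈-intro (- q)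
    (trans (neg-sub x x′) (trans (cong -_ eq) (neg-distribˡ-* q (+ m))))
    where
    neg-sub : ∀ x y → (- x) - (- y) ≡ - (x - y)
    neg-sub = solve-∀

  ≈-*ˡ : ∀ c {x x′} → x ≈[ m ] x′ → c * x ≈[ m ] c * x′
  ≈-*ˡ c {x} {x′} (mk≈ (S.divides q eq)) = ≈-intro (c * q)
    (trans (*-sub c x x′) (trans (cong (c *_) eq) (sym (*-assoc c q (+ m)))))
    where
    *-sub : ∀ c x y → c * x - c * y ≡ c * (x - y)
    *-sub = solve-∀

  ≈-cancelˡ : ∀ c {x y} → c + x ≈[ m ] c + y → x ≈[ m ] y
  ≈-cancelˡ c {x} {y} c+x≈c+y =
    ≈-trans (≈-reflexive (sym (cancel c x))) (≈-trans (≈-+ (≈-refl { - c}) c+x≈c+y) (≈-reflexive (cancel c y)))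
    where
    cancel : ∀ c x → - c + (c + x) ≡ x
    cancel = solve-∀

  x-y≈0⇒x≈y : ∀ {x y} → x - y ≈[ m ] 0ℤ → x ≈[ m ] y
  x-y≈0⇒x≈y {x} {y} (mk≈ (S.divides q eq)) = ≈-intro q (trans (sym (+-identityʳ (x - y))) eq)

  x≈y⇒x-y≈0 : ∀ {x y} → x ≈[ m ] y → x - y ≈[ m ] 0ℤ
  x≈y⇒x-y≈0 {x} {y} (mk≈ (S.divides q eq)) = ≈-intro q (trans (+-identityʳ (x - y)) eq)

  ≈0⇒∣ : ∀ {x} → x ≈[ m ] 0ℤ → + m S.∣ x
  ≈0⇒∣ {x} (mk≈ m∣x-0) = subst (+ m S.∣_) (+-identityʳ x) m∣x-0

  ∣⇒≈0 : ∀ {x} → + m S.∣ x → x ≈[ m ] 0ℤ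
  ∣⇒≈0 {x} m∣x = mk≈ (subst (+ m S.∣_) (sym (+-identityʳ x)) m∣x)

  sumℤ-≈ : ∀ {p} {f g : Fin p → ℤ} → (∀ j → f j ≈[ m ] g j) → sumℤ f ≈[ m ] sumℤ g
  sumℤ-≈ {zero}  f≈g = ≈-refl
  sumℤ-≈ {suc p} f≈g = ≈-+ (f≈g zero) (sumℤ-≈ (f≈g ∘ suc))

  *ᵛ-≈ : ∀ {r p} (A : Matrix r p) {x y : Fin p → ℤ} → (∀ l → x l ≈[ m ] y l) → ∀ i → (A *ᵛ x) i ≈[ m ] (A *ᵛ y) i
  *ᵛ-≈ A x≈y i = sumℤ-≈ (λ l → ≈-*ˡ (A i l) (x≈y l))

  ≈-<⇒≡ : ∀ {a b} → a ℕ.< m → b ℕ.< m → + a ≈[ m ] + b → a ≡ b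
  ≈-<⇒≡ {a} {b} a<m b<m (mk≈ m∣a-b) = ℤ.+-injective (ℤ.i-j≡0⇒i≡j (+ a) (+ b) (small-multiple≡0 (+ a - + b) ∣a-b∣<m m∣a-b))
    where
    ∣a-b∣<m : ℤ.∣ + a - + b ∣ ℕ.< m
    ∣a-b∣<m = ℕ.≤-<-trans (ℕ.≤-reflexive (cong ℤ.∣_∣ (ℤ.m-n≡m⊖n a b)))
               (ℕ.≤-<-trans (ℤ.∣m⊝n∣≤m⊔n a b) (ℕ.⊔-lub a<m b<m))
    small-multiple≡0 : ∀ i → ℤ.∣ i ∣ ℕ.< m → + m S.∣ i → i ≡ 0ℤ
    small-multiple≡0 i ∣i∣<m m∣i with ℤ.∣ i ∣ in ∣i∣≡ | S.∣⇒∣ᵤ m∣i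
    ... | zero  | _    = ℤ.∣i∣≡0⇒i≡0 ∣i∣≡
    ... | suc t | m∣1+t = contradiction (ℕ.∣⇒≤ m∣1+t) (ℕ.<⇒≱ ∣i∣<m)

≈⇒≡[mod] : ∀ {m x y} → x ≈[ m ] y → x ≡[mod m ] y
≈⇒≡[mod] (mk≈ m∣x-y) = S.∣⇒∣ᵤ m∣x-y

≡[mod]⇒≈ : ∀ {m x y} → x ≡[mod m ] y → x ≈[ m ] y
≡[mod]⇒≈ m∣x-y = mk≈ (S.∣ᵤ⇒∣ m∣x-y)

module _ (m : ℕ) {{_ : NonZero m}} where

  residue : ℤ → Fin m
  residue x = Fin.fromℕ< (ℤ.n%ℕd<d x m)

  residue-≈ : ∀ x → + toℕ (residue x) ≈[ m ] x
  residue-≈ x = ≈-intro (- (x ℤ./ℕ m)) (begin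
    + toℕ (residue x) - x                         ≡⟨ cong (λ t → + t - x) (Fin.toℕ-fromℕ< (ℤ.n%ℕd<d x m)) ⟩
    + (x ℤ.%ℕ m) - x                              ≡⟨ cong (_-_ (+ (x ℤ.%ℕ m))) (ℤ.a≡a%ℕn+[a/ℕn]*n x m) ⟩
    + (x ℤ.%ℕ m) - (+ (x ℤ.%ℕ m) + (x ℤ./ℕ m) * + m) ≡⟨ cancel (+ (x ℤ.%ℕ m)) (x ℤ./ℕ m) (+ m) ⟩
    - (x ℤ./ℕ m) * + m                            ∎)
    where
    open ≡-Reasoning
    cancel : ∀ r q m → r - (r + q * m) ≡ - q * m
    cancel = solve-∀

  residue-cong : ∀ {x y} → x ≈[ m ] y → residue x ≡ residue y
  residue-cong {x} {y} x≈y = Fin.toℕ-injective (≈-<⇒≡ (Fin.toℕ<n (residue x)) (Fin.toℕ<n (residue y))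
    (≈-trans (residue-≈ x) (≈-trans x≈y (≈-sym (residue-≈ y)))))

  residue-injective : ∀ {x y} → residue x ≡ residue y → x ≈[ m ] y
  residue-injective {x} {y} eq =
    ≈-trans (≈-sym (residue-≈ x)) (≈-trans (≈-reflexive (cong (λ t → + toℕ t) eq)) (residue-≈ y))

  residue-toℕ : ∀ (i : Fin m) → residue (+ toℕ i) ≡ i
  residue-toℕ i = Fin.toℕ-injective (trans (Fin.toℕ-fromℕ< _) (ℕ.m<n⇒m%n≡m (Fin.toℕ<n i)))

  mod≡residue : ∀ x → x mod m ≡ residue (+ x)
  mod≡residue x = Fin.toℕ-injective (trans (Fin.toℕ-fromℕ< _) (sym (Fin.toℕ-fromℕ< (ℤ.n%ℕd<d (+ x) m))))

-- Arithmetic of ℤ/k on Fin k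

∸≈neg : ∀ (k j : ℕ) → j ℕ.≤ k → + (k ℕ.∸ j) ≈[ k ] - + j
∸≈neg k j j≤k = ≈-intro 1ℤ (begin
  + (k ℕ.∸ j) - - + j   ≡⟨ cong (_+_ (+ (k ℕ.∸ j))) (neg-involutive (+ j)) ⟩
  + (k ℕ.∸ j) + + j     ≡⟨ pos-+ (k ℕ.∸ j) j ⟨
  + (k ℕ.∸ j ℕ.+ j)     ≡⟨ cong +_ (ℕ.m∸n+n≡m j≤k) ⟩
  + k                   ≡⟨ *-identityˡ (+ k) ⟨
  1ℤ * + k              ∎)
  where open ≡-Reasoning

module _ {k : ℕ} {{_ : NonZero k}} where

  infixl 6 _⊕_
  _⊕_ : Fin k → ℤ → Fin k
  c ⊕ s = residue k (+ toℕ c + s)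

  ⊕-identityʳ : ∀ c → c ⊕ 0ℤ ≡ c
  ⊕-identityʳ c = trans (cong (residue k) (+-identityʳ (+ toℕ c))) (residue-toℕ k c)

  ⊕-assoc : ∀ c s t → c ⊕ s ⊕ t ≡ c ⊕ (s + t)
  ⊕-assoc c s t = residue-cong k (≈-trans (≈-+ (residue-≈ k (+ toℕ c + s)) (≈-refl {x = t}))
                                          (≈-reflexive (+-assoc (+ toℕ c) s t)))

  ⊕-cong : ∀ c {s t} → s ≈[ k ] t → c ⊕ s ≡ c ⊕ t
  ⊕-cong c s≈t = residue-cong k (≈-+ (≈-refl {x = + toℕ c}) s≈t)

  ⊕-inverseʳ : ∀ c s → c ⊕ s ⊕ - s ≡ c
  ⊕-inverseʳ c s = trans (⊕-assoc c s (- s)) (trans (cong (c ⊕_) (+-inverseʳ s)) (⊕-identityʳ c))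

  ⊕-inverseˡ : ∀ c s → c ⊕ - s ⊕ s ≡ c
  ⊕-inverseˡ c s = trans (⊕-assoc c (- s) s) (trans (cong (c ⊕_) (+-inverseˡ s)) (⊕-identityʳ c))

  suc-mod≡⊕1 : ∀ c → suc (toℕ c) mod k ≡ c ⊕ 1ℤ
  suc-mod≡⊕1 c = trans (mod≡residue k (suc (toℕ c))) (cong (residue k) (trans (cong +_ (ℕ.+-comm 1 (toℕ c))) (pos-+ (toℕ c) 1)))

  ∸-mod≡⊕neg : ∀ c j → j ℕ.≤ k → (toℕ c ℕ.+ (k ℕ.∸ j)) mod k ≡ c ⊕ - + j
  ∸-mod≡⊕neg c j j≤k = trans (mod≡residue k _)
    (residue-cong k (≈-trans (≈-reflexive (pos-+ (toℕ c) (k ℕ.∸ j))) (≈-+ (≈-refl {x = + toℕ c}) (∸≈neg k j j≤k))))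

sumℤ-rotate : ∀ {m} (f : Fin (suc m) → ℤ) → sumℤ f ≡ sumℤ (λ j → f (j ⊕ 1ℤ))
sumℤ-rotate {m} f = sym (begin
  sumℤ (λ j → f (j ⊕ 1ℤ))                                   ≡⟨ sumℤ-init-last (λ j → f (j ⊕ 1ℤ)) ⟩
  sumℤ (λ j → f (inject₁ j ⊕ 1ℤ)) + f (fromℕ m ⊕ 1ℤ)        ≡⟨ cong₂ _+_ (sumℤ-cong (cong f ∘ inject₁⊕1)) (cong f last⊕1) ⟩
  sumℤ (f ∘ suc) + f zero                                   ≡⟨ +-comm (sumℤ (f ∘ suc)) (f zero) ⟩
  sumℤ f                                                    ∎)
  where
  open ≡-Reasoning
  inject₁⊕1 : ∀ j → inject₁ j ⊕ 1ℤ ≡ suc j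
  inject₁⊕1 j = trans (cong (residue (suc m)) (trans (sym (pos-+ (toℕ (inject₁ j)) 1))
                        (cong +_ (trans (ℕ.+-comm (toℕ (inject₁ j)) 1) (cong suc (toℕ-inject₁ j))))))
                      (residue-toℕ (suc m) (suc j))
  last⊕1 : fromℕ m ⊕ 1ℤ ≡ zero
  last⊕1 = trans (residue-cong (suc m) (≈-trans (≈-reflexive (trans (sym (pos-+ (toℕ (fromℕ m)) 1))
                      (cong +_ (trans (ℕ.+-comm (toℕ (fromℕ m)) 1) (cong suc (Fin.toℕ-fromℕ m))))))
                      (≈-intro {y = 0ℤ} 1ℤ (trans (+-identityʳ (+ suc m)) (sym (*-identityˡ (+ suc m)))))))
                 (residue-toℕ (suc m) zero)

module _ (d n : ℕ) {{_ : NonZero n}} where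
  private
    instance
      gcd≢0 : NonZero (gcd d n)
      gcd≢0 = gcdNonZero d n
    d/g*g≡d : (d / gcd d n) ℕ.* gcd d n ≡ d
    d/g*g≡d = ℕ.m/n*n≡m (gcd[m,n]∣m d n)
    n/g*g≡n : (n / gcd d n) ℕ.* gcd d n ≡ n
    n/g*g≡n = ℕ.m/n*n≡m (gcd[m,n]∣n d n)

  n/gcd∣⇒n∣d* : ∀ t → (n / gcd d n) ℕ.∣ t → n ℕ.∣ d ℕ.* t
  n/gcd∣⇒n∣d* t n/g∣t = subst₂ ℕ._∣_ n/g*g≡n (ℕ.*-comm t d) (ℕ.*-pres-∣ n/g∣t (gcd[m,n]∣m d n))

  n∣d*⇒n/gcd∣ : ∀ t → n ℕ.∣ d ℕ.* t → (n / gcd d n) ℕ.∣ t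
  n∣d*⇒n/gcd∣ t n∣dt = coprime-divisor (Coprime.sym (coprime-/gcd d n)) (ℕ.*-cancelʳ-∣ (gcd d n) n/g*g∣d/g*t*g)
    where
    n/g*g∣d/g*t*g : (n / gcd d n) ℕ.* gcd d n ℕ.∣ (d / gcd d n) ℕ.* t ℕ.* gcd d n
    n/g*g∣d/g*t*g = subst₂ ℕ._∣_ (sym n/g*g≡n)
      (trans (cong (ℕ._* t) (sym d/g*g≡d)) (xy∙z≈xz∙y (d / gcd d n) (gcd d n) t)) n∣dt

  n/gcd∣⇒n∣d*ℤ : ∀ u → + (n / gcd d n) S.∣ u → + n S.∣ + d * u
  n/gcd∣⇒n∣d*ℤ u h = S.∣ᵤ⇒∣ (subst (n ℕ.∣_) (sym (ℤ.abs-* (+ d) u)) (n/gcd∣⇒n∣d* ℤ.∣ u ∣ (S.∣⇒∣ᵤ h)))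

  n∣d*⇒n/gcd∣ℤ : ∀ u → + n S.∣ + d * u → + (n / gcd d n) S.∣ u
  n∣d*⇒n/gcd∣ℤ u h = S.∣ᵤ⇒∣ (n∣d*⇒n/gcd∣ ℤ.∣ u ∣ (subst (n ℕ.∣_) (ℤ.abs-* (+ d) u) (S.∣⇒∣ᵤ h)))

injective⇒surjective : ∀ {N} (h : Fin N → Fin N) → (∀ {x y} → h x ≡ h y → x ≡ y) → ∀ y → Σ (Fin N) (λ x → h x ≡ y)
injective⇒surjective {suc N} h h-injective y with Fin.any? (λ x → h x Fin.≟ y)
... | yes hit = hit
... | no miss = contradiction (Fin.injective⇒≤ h′-injective) ℕ.1+n≰n
  where
  y≢h : ∀ x → y ≢ h x
  y≢h x y≡hx = miss (x , sym y≡hx)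
  h′ : Fin (suc N) → Fin N
  h′ x = punchOut (y≢h x)
  h′-injective : ∀ {x z} → h′ x ≡ h′ z → x ≡ z
  h′-injective {x} {z} eq = h-injective (Fin.punchOut-injective (y≢h x) (y≢h z) eq)

funToFin-cong : ∀ {m n} {f g : Fin m → Fin n} → f ≗ g → funToFin f ≡ funToFin g
funToFin-cong {zero}  f≗g = refl
funToFin-cong {suc m} f≗g = cong₂ Fin.combine (f≗g zero) (funToFin-cong (f≗g ∘ suc))

-- Coded in Fin (n ^ m), g becomes injective, hence surjective, because f ∘ g is the identity.
rightInverse⇒leftInverse : ∀ {m n} (f g : (Fin m → Fin n) → (Fin m → Fin n)) →
  (∀ {v w} → v ≗ w → f v ≗ f w) → (∀ {v w} → v ≗ w → g v ≗ g w) →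
  (∀ v → f (g v) ≗ v) → ∀ v → g (f v) ≗ v
rightInverse⇒leftInverse {m} {n} f g f-cong g-cong fg≗id v j = begin
  g (f v) j                              ≡⟨ g-cong (f-cong (Fin.finToFun-funToFin v)) j ⟨
  g (f (finToFun (funToFin v))) j        ≡⟨ g-cong (Fin.finToFun-funToFin (f (finToFun (funToFin v)))) j ⟨
  g (finToFun (F (funToFin v))) j        ≡⟨ Fin.finToFun-funToFin (g (finToFun (F (funToFin v)))) j ⟨
  finToFun (G (F (funToFin v))) j        ≡⟨ cong (λ t → finToFun t j) (G∘F≡id (funToFin v)) ⟩
  finToFun (funToFin v) j                ≡⟨ Fin.finToFun-funToFin v j ⟩
  v j                                    ∎
  where
  open ≡-Reasoning
  F G : Fin (n ℕ.^ m) → Fin (n ℕ.^ m)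
  F t = funToFin (f (finToFun t))
  G t = funToFin (g (finToFun t))
  F∘G≡id : ∀ t → F (G t) ≡ t
  F∘G≡id t = trans (funToFin-cong (f-cong (Fin.finToFun-funToFin (g (finToFun t)))))
                   (trans (funToFin-cong (fg≗id (finToFun t))) (Fin.funToFin-finToFin {m} {n} t))
  G∘F≡id : ∀ t → G (F t) ≡ t
  G∘F≡id t with s , refl ← injective⇒surjective G (λ {x} {y} eq → trans (sym (F∘G≡id x)) (trans (cong F eq) (F∘G≡id y))) t
    = cong G (F∘G≡id s)

-- The monodromy group as a semidirect product

module Realisation (k₂ n : ℕ) {{_ : NonZero n}} (a : Fin (2 ℕ.+ k₂) → ℕ) (U V : Matrix (2 ℕ.+ k₂) (2 ℕ.+ k₂))
                   (d : Fin (2 ℕ.+ k₂) → ℕ) (snf : IsSNF (circulant (2 ℕ.+ k₂) a) U d V) where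

  k : ℕ
  k = 2 ℕ.+ k₂

  C W : Matrix k k
  C = circulant k a
  W = U ⊗ diag d

  δs : Fin k → ℕ
  δs = δ k n d

  Vec : Set
  Vec = Fin k → ℤ

  embed : Vec → Vec
  embed x = W *ᵛ x

  embed-column : ∀ j → embed (λ l → V l j) ≗ λ i → C i j
  embed-column j i = sym (IsSNF.factor snf i j)

  embed-V : ∀ y → embed (V *ᵛ y) ≗ C *ᵛ y
  embed-V y i = trans (sym (⊗-*ᵛ W V y i)) (sumℤ-cong (λ l → cong (_* y l) (sym (IsSNF.factor snf i l))))

  embed-+ : ∀ x y → embed (λ l → x l + y l) ≗ λ i → embed x i + embed y i
  embed-+ = *ᵛ-distrib-+ W

  embed-neg : ∀ x → embed (λ l → - x l) ≗ λ i → - embed x i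
  embed-neg = *ᵛ-neg W

  embed-sub : ∀ x y → embed (λ l → x l - y l) ≗ λ i → embed x i - embed y i
  embed-sub x y i = trans (embed-+ x (λ l → - y l) i) (cong (_+_ (embed x i)) (embed-neg y i))

  embed-zero : embed (λ _ → 0ℤ) ≗ λ _ → 0ℤ
  embed-zero = *ᵛ-zero W

  embed-diag : ∀ u → embed u ≗ U *ᵛ (λ l → + d l * u l)
  embed-diag u i = trans (⊗-*ᵛ U (diag d) u i) (*ᵛ-cong U (diag-*ᵛ d u) i)

  C-index : ∀ i j → C i j ≡ + a (i ⊕ - + toℕ j)
  C-index i j = cong (λ c → + a c) (∸-mod≡⊕neg i (toℕ j) (ℕ.<⇒≤ (Fin.toℕ<n j)))

  C-column₀ : ∀ c → C c zero ≡ + a c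
  C-column₀ c = trans (C-index c zero) (cong (λ i → + a i) (⊕-identityʳ c))

  C-column₁ : ∀ c → C c (suc zero) ≡ + a (c ⊕ -1ℤ)
  C-column₁ c = C-index c (suc zero)

  rotate : Vec → Vec
  rotate v c = v (c ⊕ -1ℤ)

  C-rotate : ∀ y → C *ᵛ rotate y ≗ rotate (C *ᵛ y)
  C-rotate y i = trans (sumℤ-rotate (λ j → C i j * y (j ⊕ -1ℤ)))
    (sumℤ-cong (λ j → cong₂ _*_ (C-shift j) (cong y (⊕-inverseʳ j 1ℤ))))
    where
    negate-succ : ∀ x → - (x + 1ℤ) ≡ -1ℤ + - x
    negate-succ = solve-∀
    C-shift : ∀ j → C i (j ⊕ 1ℤ) ≡ C (i ⊕ -1ℤ) j
    C-shift j = begin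
      C i (j ⊕ 1ℤ)                     ≡⟨ C-index i (j ⊕ 1ℤ) ⟩
      + a (i ⊕ - + toℕ (j ⊕ 1ℤ))       ≡⟨ cong (λ c → + a c) (⊕-cong i (≈-neg (residue-≈ k (+ toℕ j + 1ℤ)))) ⟩
      + a (i ⊕ - (+ toℕ j + 1ℤ))       ≡⟨ cong (λ s → + a (i ⊕ s)) (negate-succ (+ toℕ j)) ⟩
      + a (i ⊕ (-1ℤ + - + toℕ j))      ≡⟨ cong (λ c → + a c) (⊕-assoc i -1ℤ (- + toℕ j)) ⟨
      + a (i ⊕ -1ℤ ⊕ - + toℕ j)        ≡⟨ C-index (i ⊕ -1ℤ) j ⟨
      C (i ⊕ -1ℤ) j                    ∎
      where open ≡-Reasoning

  V⁻¹ U⁻¹ : Matrix k k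
  V⁻¹ = inverse V
  U⁻¹ = inverse U

  V*V⁻¹ : ∀ z → V *ᵛ (V⁻¹ *ᵛ z) ≗ z
  V*V⁻¹ = *ᵛ-inverse V (IsSNF.detV snf)

  U*U⁻¹ : ∀ z → U *ᵛ (U⁻¹ *ᵛ z) ≗ z
  U*U⁻¹ = *ᵛ-inverse U (IsSNF.detU snf)

  -- The rotation conjugated by V: since the circulant C = W V commutes with rotation, embed intertwines the two.
  shift : Vec → Vec
  shift z = V *ᵛ rotate (V⁻¹ *ᵛ z)

  embed-shift : ∀ z → embed (shift z) ≗ rotate (embed z)
  embed-shift z i = begin
    embed (V *ᵛ rotate (V⁻¹ *ᵛ z)) i   ≡⟨ embed-V (rotate (V⁻¹ *ᵛ z)) i ⟩
    (C *ᵛ rotate (V⁻¹ *ᵛ z)) i         ≡⟨ C-rotate (V⁻¹ *ᵛ z) i ⟩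
    (C *ᵛ (V⁻¹ *ᵛ z)) (i ⊕ -1ℤ)        ≡⟨ embed-V (V⁻¹ *ᵛ z) (i ⊕ -1ℤ) ⟨
    embed (V *ᵛ (V⁻¹ *ᵛ z)) (i ⊕ -1ℤ)  ≡⟨ *ᵛ-cong W (V*V⁻¹ z) (i ⊕ -1ℤ) ⟩
    embed z (i ⊕ -1ℤ)                  ∎
    where open ≡-Reasoning

  embed-shift^ : ∀ j z i → embed (fold z shift j) i ≡ embed z (i ⊕ - + j)
  embed-shift^ zero    z i = cong (embed z) (sym (⊕-identityʳ i))
  embed-shift^ (suc j) z i = begin
    embed (shift (fold z shift j)) i  ≡⟨ embed-shift (fold z shift j) i ⟩
    embed (fold z shift j) (i ⊕ -1ℤ)  ≡⟨ embed-shift^ j z (i ⊕ -1ℤ) ⟩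
    embed z (i ⊕ -1ℤ ⊕ - + j)         ≡⟨ cong (embed z) (⊕-assoc i -1ℤ (- + j)) ⟩
    embed z (i ⊕ (-1ℤ + - + j))       ≡⟨ cong (λ s → embed z (i ⊕ s)) (negate-suc j) ⟩
    embed z (i ⊕ - + suc j)           ∎
    where
    open ≡-Reasoning
    negate-suc : ∀ j → -1ℤ + - + j ≡ - + suc j
    negate-suc j = trans (sym (neg-distrib-+ 1ℤ (+ j))) (cong -_ (sym (pos-+ 1 j)))

  act : ℤ → Vec → Vec
  act s z = fold z shift (s ℤ.%ℕ k)

  %ℕ≈ : ∀ s → + (s ℤ.%ℕ k) ≈[ k ] s
  %ℕ≈ s = ≈-trans (≈-reflexive (cong +_ (sym (Fin.toℕ-fromℕ< _)))) (residue-≈ k s)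

  embed-act : ∀ s z i → embed (act s z) i ≡ embed z (i ⊕ - s)
  embed-act s z i = trans (embed-shift^ (s ℤ.%ℕ k) z i) (cong (embed z) (⊕-cong i (≈-neg (%ℕ≈ s))))

  lift : (Fin k → Fin n) → Vec
  lift v l = + toℕ (v l)

  Umod U⁻¹mod : (Fin k → Fin n) → Fin k → Fin n
  Umod    v = residue n ∘ (U *ᵛ lift v)
  U⁻¹mod  v = residue n ∘ (U⁻¹ *ᵛ lift v)

  Umod∘U⁻¹mod : ∀ v → Umod (U⁻¹mod v) ≗ v
  Umod∘U⁻¹mod v j = trans (residue-cong n (≈-trans (*ᵛ-≈ U (λ l → residue-≈ n ((U⁻¹ *ᵛ lift v) l)) j)
                                                   (≈-reflexive (U*U⁻¹ (lift v) j))))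
                          (residue-toℕ n (v j))

  U⁻¹mod∘Umod : ∀ v → U⁻¹mod (Umod v) ≗ v
  U⁻¹mod∘Umod = rightInverse⇒leftInverse Umod U⁻¹mod (λ v≗w → cong (residue n) ∘ *ᵛ-cong U (cong (+_ ∘ toℕ) ∘ v≗w))
                                                     (λ v≗w → cong (residue n) ∘ *ᵛ-cong U⁻¹ (cong (+_ ∘ toℕ) ∘ v≗w))
                                                     Umod∘U⁻¹mod

  -- U is invertible over ℤ/n because it has a right inverse there and (ℤ/n)ᵏ is finite.
  U-injectiveModulo : ∀ v → (∀ i → (U *ᵛ v) i ≈[ n ] 0ℤ) → ∀ i → v i ≈[ n ] 0ℤ
  U-injectiveModulo v Uv≈0 i = residue-injective n (begin
    residue n (v i)                 ≡⟨ U⁻¹mod∘Umod v̄ i ⟨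
    U⁻¹mod (Umod v̄) i               ≡⟨ cong (residue n) (*ᵛ-cong U⁻¹ (cong (+_ ∘ toℕ) ∘ Umod-v̄≡0) i) ⟩
    U⁻¹mod (λ _ → residue n 0ℤ) i   ≡⟨ residue-cong n (≈-trans (*ᵛ-≈ U⁻¹ (λ _ → residue-≈ n 0ℤ) i)
                                                                (≈-reflexive (*ᵛ-zero U⁻¹ i))) ⟩
    residue n 0ℤ                    ∎)
    where
    open ≡-Reasoning
    v̄ : Fin k → Fin n
    v̄ = residue n ∘ v
    Umod-v̄≡0 : ∀ l → Umod v̄ l ≡ residue n 0ℤ
    Umod-v̄≡0 l = residue-cong n (≈-trans (*ᵛ-≈ U (residue-≈ n ∘ v) l) (Uv≈0 l))

  embed-injective : ∀ x y → (∀ i → embed x i ≈[ n ] embed y i) → ∀ l → x l ≈[ δs l ] y l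
  embed-injective x y embed-x≈y l = mk≈ (n∣d*⇒n/gcd∣ℤ (d l) n (x l - y l) (≈0⇒∣ (U-injectiveModulo D UD≈0 l)))
    where
    D : Vec
    D l = + d l * (x l - y l)
    UD≈0 : ∀ i → (U *ᵛ D) i ≈[ n ] 0ℤ
    UD≈0 i = subst (_≈[ n ] 0ℤ) (trans (sym (embed-sub x y i)) (embed-diag (λ l → x l - y l) i))
                   (x≈y⇒x-y≈0 (embed-x≈y i))

  embed-cong : ∀ x y → (∀ l → x l ≈[ δs l ] y l) → ∀ i → embed x i ≈[ n ] embed y i
  embed-cong x y x≈y i = x-y≈0⇒x≈y (subst (_≈[ n ] 0ℤ) (trans (sym (embed-diag (λ l → x l - y l) i)) (embed-sub x y i))
    (≈-trans (*ᵛ-≈ U (λ l → ∣⇒≈0 (n/gcd∣⇒n∣d*ℤ (d l) n (x l - y l) (divides (x≈y l)))) i) (≈-reflexive (*ᵛ-zero U i))))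

  embed-≡⇒≡[mod] : ∀ x y → (∀ i → embed x i ≡ embed y i) → ∀ l → x l ≡[mod δs l ] y l
  embed-≡⇒≡[mod] x y embed-x≡y l = ≈⇒≡[mod] (embed-injective x y (≈-reflexive ∘ embed-x≡y) l)

  act-isCkAction : IsCkAction k δs act
  act-isCkAction = record
    { cong     = λ s x y x≡y l → ≈⇒≡[mod] (embed-injective (act s x) (act s y) (λ i →
                   ≈-trans (≈-reflexive (embed-act s x i))
                   (≈-trans (embed-cong x y (≡[mod]⇒≈ ∘ x≡y) (i ⊕ - s)) (≈-reflexive (sym (embed-act s y i))))) l)
    ; additive = λ s x y → embed-≡⇒≡[mod] (act s (λ l → x l + y l)) (λ l → act s x l + act s y l) λ i → begin
        embed (act s (λ l → x l + y l)) i          ≡⟨ embed-act s (λ l → x l + y l) i ⟩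
        embed (λ l → x l + y l) (i ⊕ - s)          ≡⟨ embed-+ x y (i ⊕ - s) ⟩
        embed x (i ⊕ - s) + embed y (i ⊕ - s)      ≡⟨ cong₂ _+_ (embed-act s x i) (embed-act s y i) ⟨
        embed (act s x) i + embed (act s y) i      ≡⟨ embed-+ (act s x) (act s y) i ⟨
        embed (λ l → act s x l + act s y l) i      ∎
    ; zeroAct  = λ x l → ≈⇒≡[mod] (≈-refl {x = x l})
    ; compAct  = λ s t x → embed-≡⇒≡[mod] (act (s + t) x) (act s (act t x)) λ i → begin
        embed (act (s + t) x) i          ≡⟨ embed-act (s + t) x i ⟩
        embed x (i ⊕ - (s + t))          ≡⟨ cong (λ r → embed x (i ⊕ r)) (neg-distrib-+ s t) ⟩
        embed x (i ⊕ (- s + - t))        ≡⟨ cong (embed x) (⊕-assoc i (- s) (- t)) ⟨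
        embed x (i ⊕ - s ⊕ - t)          ≡⟨ embed-act t x (i ⊕ - s) ⟨
        embed (act t x) (i ⊕ - s)        ≡⟨ embed-act s (act t x) i ⟨
        embed (act s (act t x)) i        ∎
    ; periodic = λ x → embed-≡⇒≡[mod] (act (+ k) x) x λ i → begin
        embed (act (+ k) x) i            ≡⟨ embed-act (+ k) x i ⟩
        embed x (i ⊕ - + k)              ≡⟨ cong (embed x) (⊕-cong i (≈-neg k≈0)) ⟩
        embed x (i ⊕ - 0ℤ)               ≡⟨ cong (embed x) (⊕-identityʳ i) ⟩
        embed x i                        ∎
    }
    where
    open ≡-Reasoning
    k≈0 : + k ≈[ k ] 0ℤ
    k≈0 = ≈-intro 1ℤ (trans (+-identityʳ (+ k)) (sym (*-identityˡ (+ k))))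

  open RawGroup (Semidirect k δs act) using (_∙_; _⁻¹) renaming (Carrier to G; _≈_ to _≈G_)

  Pt : Set
  Pt = Point n k

  perm : G → Pt → Pt
  perm (x , s) (m , i) = residue n (+ toℕ m + embed x (i ⊕ s)) , i ⊕ s

  perm-∙ : ∀ g h p → perm (g ∙ h) p ≡ perm g (perm h p)
  perm-∙ (x , s) (y , t) (m , i) = cong₂ _,_ translation rotation
    where
    rotation : i ⊕ (s + t) ≡ i ⊕ t ⊕ s
    rotation = trans (cong (i ⊕_) (+-comm s t)) (sym (⊕-assoc i t s))
    rotation′ : i ⊕ (s + t) ⊕ - s ≡ i ⊕ t
    rotation′ = trans (cong (_⊕ - s) rotation) (⊕-inverseʳ (i ⊕ t) s)
    reorder : ∀ m a b → m + (a + b) ≡ m + b + a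
    reorder = solve-∀
    translation : residue n (+ toℕ m + embed (λ l → x l + act s y l) (i ⊕ (s + t)))
                ≡ residue n (+ toℕ (residue n (+ toℕ m + embed y (i ⊕ t))) + embed x (i ⊕ t ⊕ s))
    translation = residue-cong n (≈-trans (≈-reflexive (begin
      + toℕ m + embed (λ l → x l + act s y l) (i ⊕ (s + t))
        ≡⟨ cong (_+_ (+ toℕ m)) (embed-+ x (act s y) (i ⊕ (s + t))) ⟩
      + toℕ m + (embed x (i ⊕ (s + t)) + embed (act s y) (i ⊕ (s + t)))
        ≡⟨ cong (λ e → + toℕ m + (embed x (i ⊕ (s + t)) + e)) (trans (embed-act s y _) (cong (embed y) rotation′)) ⟩
      + toℕ m + (embed x (i ⊕ (s + t)) + embed y (i ⊕ t))
        ≡⟨ reorder (+ toℕ m) (embed x (i ⊕ (s + t))) (embed y (i ⊕ t)) ⟩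
      + toℕ m + embed y (i ⊕ t) + embed x (i ⊕ (s + t))
        ≡⟨ cong (λ c → + toℕ m + embed y (i ⊕ t) + embed x c) rotation ⟩
      + toℕ m + embed y (i ⊕ t) + embed x (i ⊕ t ⊕ s) ∎))
      (≈-+ (≈-sym (residue-≈ n (+ toℕ m + embed y (i ⊕ t)))) ≈-refl))
      where open ≡-Reasoning

  perm-cong : ∀ g h → g ≈G h → perm g ≗ perm h
  perm-cong (x , s) (y , t) (x≡y , s≡t) (m , i) = cong₂ _,_
    (trans (cong (λ c → residue n (+ toℕ m + embed x c)) rotation)
           (residue-cong n (≈-+ (≈-refl {x = + toℕ m}) (embed-cong x y (≡[mod]⇒≈ ∘ x≡y) (i ⊕ t)))))
    rotation
    where
    rotation : i ⊕ s ≡ i ⊕ t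
    rotation = ⊕-cong i (≡[mod]⇒≈ {x = s} {y = t} s≡t)

  perm-faithful : ∀ g h → perm g ≗ perm h → g ≈G h
  perm-faithful (x , s) (y , t) g≗h = (≈⇒≡[mod] ∘ embed-injective x y embed-x≈y) , ≈⇒≡[mod] s≈t
    where
    m₀ : Fin n
    m₀ = residue n 0ℤ
    s≈t : s ≈[ k ] t
    s≈t = ≈-cancelˡ (+ toℕ (zero {k₂})) (residue-injective k (cong proj₂ (g≗h (m₀ , zero))))
    embed-x≈y : ∀ c → embed x c ≈[ n ] embed y c
    embed-x≈y c = ≈-trans (≈-reflexive (cong (embed x) (sym (⊕-inverseˡ c s))))
                  (≈-trans (≈-cancelˡ (+ toℕ m₀) (residue-injective n (cong proj₁ (g≗h (m₀ , c ⊕ - s)))))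
                  (≈-reflexive (cong (embed y) (trans (⊕-cong (c ⊕ - s) (≈-sym s≈t)) (⊕-inverseˡ c s)))))

  perm-trivial : ∀ y s → (∀ c → embed y c ≈[ n ] 0ℤ) → s ≈[ k ] 0ℤ → ∀ p → perm (y , s) p ≡ p
  perm-trivial y s embed-y≈0 s≈0 (m , i) = cong₂ _,_
    (trans (residue-cong n (≈-trans (≈-+ (≈-refl {x = + toℕ m}) (embed-y≈0 (i ⊕ s))) (≈-reflexive (+-identityʳ (+ toℕ m)))))
           (residue-toℕ n m))
    (trans (⊕-cong i s≈0) (⊕-identityʳ i))

  runLetter : Letter → Pt → Pt
  runLetter = letterAct k n a

  runWord : List Letter → Pt → Pt
  runWord = wordAct k n a

  letter : Letter → G
  letter s0  = (λ _ → 0ℤ) , 1ℤ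
  letter s0⁻ = (λ _ → 0ℤ) , -1ℤ
  letter s1  = (λ l → - V l zero) , -1ℤ
  letter s1⁻ = (λ l → V l (suc zero)) , 1ℤ

  evaluate : List Letter → G
  evaluate []      = (λ _ → 0ℤ) , 0ℤ
  evaluate (x ∷ w) = letter x ∙ evaluate w

  perm-rotation : ∀ s m i → perm ((λ _ → 0ℤ) , s) (m , i) ≡ (m , i ⊕ s)
  perm-rotation s m i = cong (_, i ⊕ s)
    (trans (cong (residue n) (trans (cong (_+_ (+ toℕ m)) (embed-zero (i ⊕ s))) (+-identityʳ (+ toℕ m))))
           (residue-toℕ n m))

  subN≡residue : ∀ x y → subN k n a x y ≡ residue n (+ x - + y)
  subN≡residue x y = trans (mod≡residue n (x ℕ.+ (n ℕ.∸ toℕ (y mod n))))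
    (residue-cong n (≈-trans (≈-reflexive (pos-+ x _)) (≈-+ (≈-refl {x = + x}) (≈-trans
      (∸≈neg n _ (ℕ.<⇒≤ (Fin.toℕ<n (y mod n))))
      (≈-neg (≈-trans (≈-reflexive (cong (+_ ∘ toℕ) (mod≡residue n y))) (residue-≈ n (+ y))))))))

  perm-letter : ∀ x → perm (letter x) ≗ runLetter x
  perm-letter s0  (m , i) = trans (perm-rotation 1ℤ m i) (cong (m ,_) (sym (suc-mod≡⊕1 i)))
  perm-letter s0⁻ (m , i) = trans (perm-rotation -1ℤ m i) (cong (m ,_) (sym (∸-mod≡⊕neg i 1 (ℕ.s≤s ℕ.z≤n))))
  perm-letter s1  (m , i) = cong₂ _,_ (begin
    residue n (+ toℕ m + embed (λ l → - V l zero) (i ⊕ -1ℤ))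
      ≡⟨ cong (λ e → residue n (+ toℕ m + e)) (trans (embed-neg (column zero) (i ⊕ -1ℤ))
                                               (cong -_ (trans (embed-column zero (i ⊕ -1ℤ)) (C-column₀ (i ⊕ -1ℤ))))) ⟩
    residue n (+ toℕ m - + a (i ⊕ -1ℤ))
      ≡⟨ cong (λ c → residue n (+ toℕ m - + a c)) (∸-mod≡⊕neg i 1 (ℕ.s≤s ℕ.z≤n)) ⟨
    residue n (+ toℕ m - + a (predK k n a i))
      ≡⟨ subN≡residue (toℕ m) (a (predK k n a i)) ⟨
    subN k n a (toℕ m) (a (predK k n a i)) ∎)
    (sym (∸-mod≡⊕neg i 1 (ℕ.s≤s ℕ.z≤n)))
    where
    open ≡-Reasoning
    column : Fin k → Vec
    column j l = V l j
  perm-letter s1⁻ (m , i) = cong₂ _,_ (begin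
    residue n (+ toℕ m + embed (λ l → V l (suc zero)) (i ⊕ 1ℤ))
      ≡⟨ cong (λ e → residue n (+ toℕ m + e)) (trans (embed-column (suc zero) (i ⊕ 1ℤ)) (C-column₁ (i ⊕ 1ℤ))) ⟩
    residue n (+ toℕ m + + a (i ⊕ 1ℤ ⊕ -1ℤ))
      ≡⟨ cong (λ c → residue n (+ toℕ m + + a c)) (⊕-inverseʳ i 1ℤ) ⟩
    residue n (+ toℕ m + + a i)
      ≡⟨ cong (residue n) (pos-+ (toℕ m) (a i)) ⟨
    residue n (+ (toℕ m ℕ.+ a i))
      ≡⟨ mod≡residue n (toℕ m ℕ.+ a i) ⟨
    (toℕ m ℕ.+ a i) mod n ∎)
    (sym (suc-mod≡⊕1 i))
    where open ≡-Reasoning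

  perm-evaluate : ∀ w → perm (evaluate w) ≗ runWord w
  perm-evaluate []      p = perm-trivial (λ _ → 0ℤ) 0ℤ (≈-reflexive ∘ embed-zero) ≈-refl p
  perm-evaluate (x ∷ w) p = begin
    perm (letter x ∙ evaluate w) p        ≡⟨ perm-∙ (letter x) (evaluate w) p ⟩
    perm (letter x) (perm (evaluate w) p) ≡⟨ perm-letter x (perm (evaluate w) p) ⟩
    runLetter x (perm (evaluate w) p)     ≡⟨ cong (runLetter x) (perm-evaluate w p) ⟩
    runLetter x (runWord w p)             ∎
    where open ≡-Reasoning

  embed-∙ : ∀ x s y t c → embed (proj₁ ((x , s) ∙ (y , t))) c ≡ embed x c + embed y (c ⊕ - s)
  embed-∙ x s y t c = trans (embed-+ x (act s y) c) (cong (_+_ (embed x c)) (embed-act s y c))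

  letter-cancel : ∀ x c → embed (proj₁ (letter (invL x) ∙ letter x)) c ≡ 0ℤ
  letter-cancel s0  c = trans (embed-∙ (λ _ → 0ℤ) -1ℤ (λ _ → 0ℤ) 1ℤ c) (cong₂ _+_ (embed-zero c) (embed-zero (c ⊕ 1ℤ)))
  letter-cancel s0⁻ c = trans (embed-∙ (λ _ → 0ℤ) 1ℤ (λ _ → 0ℤ) -1ℤ c) (cong₂ _+_ (embed-zero c) (embed-zero (c ⊕ -1ℤ)))
  letter-cancel s1  c = begin
    embed (proj₁ (letter s1⁻ ∙ letter s1)) c                             ≡⟨ embed-∙ (λ l → V l (suc zero)) 1ℤ (λ l → - V l zero) -1ℤ c ⟩
    embed (λ l → V l (suc zero)) c + embed (λ l → - V l zero) (c ⊕ -1ℤ)  ≡⟨ cong₂ _+_ (embed-column (suc zero) c)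
                                                                              (embed-neg (λ l → V l zero) (c ⊕ -1ℤ)) ⟩
    C c (suc zero) + - embed (λ l → V l zero) (c ⊕ -1ℤ)                  ≡⟨ cong₂ (λ u v → u + - v) (C-column₁ c)
                                                                              (trans (embed-column zero (c ⊕ -1ℤ)) (C-column₀ (c ⊕ -1ℤ))) ⟩
    + a (c ⊕ -1ℤ) + - + a (c ⊕ -1ℤ)                                      ≡⟨ +-inverseʳ (+ a (c ⊕ -1ℤ)) ⟩
    0ℤ                                                                   ∎
    where open ≡-Reasoning
  letter-cancel s1⁻ c = begin
    embed (proj₁ (letter s1 ∙ letter s1⁻)) c                             ≡⟨ embed-∙ (λ l → - V l zero) -1ℤ (λ l → V l (suc zero)) 1ℤ c ⟩
    embed (λ l → - V l zero) c + embed (λ l → V l (suc zero)) (c ⊕ 1ℤ)   ≡⟨ cong₂ _+_ (embed-neg (λ l → V l zero) c)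
                                                                              (embed-column (suc zero) (c ⊕ 1ℤ)) ⟩
    - embed (λ l → V l zero) c + C (c ⊕ 1ℤ) (suc zero)                   ≡⟨ cong₂ (λ u v → - u + v)
                                                                              (trans (embed-column zero c) (C-column₀ c))
                                                                              (trans (C-column₁ (c ⊕ 1ℤ)) (cong (λ i → + a i) (⊕-inverseʳ c 1ℤ))) ⟩
    - + a c + + a c                                                      ≡⟨ +-inverseˡ (+ a c) ⟩
    0ℤ                                                                   ∎
    where open ≡-Reasoning

  letter-rotation-cancel : ∀ x → proj₂ (letter (invL x) ∙ letter x) ≡ 0ℤ
  letter-rotation-cancel s0  = refl
  letter-rotation-cancel s1  = refl
  letter-rotation-cancel s0⁻ = refl
  letter-rotation-cancel s1⁻ = refl

  runLetter-inverse : ∀ x p → runLetter (invL x) (runLetter x p) ≡ p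
  runLetter-inverse x p = begin
    runLetter (invL x) (runLetter x p)             ≡⟨ cong (runLetter (invL x)) (perm-letter x p) ⟨
    runLetter (invL x) (perm (letter x) p)         ≡⟨ perm-letter (invL x) (perm (letter x) p) ⟨
    perm (letter (invL x)) (perm (letter x) p)     ≡⟨ perm-∙ (letter (invL x)) (letter x) p ⟨
    perm (letter (invL x) ∙ letter x) p            ≡⟨ perm-trivial (proj₁ (letter (invL x) ∙ letter x)) (proj₂ (letter (invL x) ∙ letter x)) (≈-reflexive ∘ letter-cancel x)
                                                                   (≈-reflexive (letter-rotation-cancel x)) p ⟩
    p                                              ∎
    where open ≡-Reasoning

  runWord-++ : ∀ w v p → runWord (w ++ v) p ≡ runWord w (runWord v p)
  runWord-++ []      v p = refl
  runWord-++ (x ∷ w) v p = cong (runLetter x) (runWord-++ w v p)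

  invertWord : List Letter → List Letter
  invertWord w = reverse (map invL w)

  runWord-inverse : ∀ w p → runWord (invertWord w) (runWord w p) ≡ p
  runWord-inverse []      p = refl
  runWord-inverse (x ∷ w) p = begin
    runWord (reverse (invL x ∷ map invL w)) (runLetter x (runWord w p))
      ≡⟨ cong (λ u → runWord u (runLetter x (runWord w p))) (unfold-reverse (invL x) (map invL w)) ⟩
    runWord (invertWord w ++ invL x ∷ []) (runLetter x (runWord w p))
      ≡⟨ runWord-++ (invertWord w) (invL x ∷ []) (runLetter x (runWord w p)) ⟩
    runWord (invertWord w) (runLetter (invL x) (runLetter x (runWord w p)))
      ≡⟨ cong (runWord (invertWord w)) (runLetter-inverse x (runWord w p)) ⟩
    runWord (invertWord w) (runWord w p)
      ≡⟨ runWord-inverse w p ⟩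
    p ∎
    where open ≡-Reasoning

  translate : Vec → Pt → Pt
  translate u (m , i) = residue n (+ toℕ m + u i) , i

  translate-translate : ∀ u v p → translate u (translate v p) ≡ translate (λ c → u c + v c) p
  translate-translate u v (m , i) = cong (_, i) (residue-cong n (≈-trans
    (≈-+ (residue-≈ n (+ toℕ m + v i)) (≈-refl {x = u i})) (≈-reflexive (reorder (+ toℕ m) (v i) (u i)))))
    where
    reorder : ∀ m v u → m + v + u ≡ m + (u + v)
    reorder = solve-∀

  translate-cong : ∀ {u v} → u ≗ v → translate u ≗ translate v
  translate-cong u≗v (m , i) = cong (λ e → residue n (+ toℕ m + e) , i) (u≗v i)

  translate-zero : ∀ {u} → u ≗ (λ _ → 0ℤ) → translate u ≗ λ p → p
  translate-zero u≗0 (m , i) = cong (_, i) (trans (cong (λ e → residue n (+ toℕ m + e)) (u≗0 i))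
                                                  (trans (cong (residue n) (+-identityʳ (+ toℕ m))) (residue-toℕ n m)))

  _Realises_ : List Letter → Vec → Set
  w Realises u = runWord w ≗ translate u

  runWord-s0^ : ∀ j m i → runWord (replicate j s0) (m , i) ≡ (m , i ⊕ + j)
  runWord-s0^ zero    m i = cong (m ,_) (sym (⊕-identityʳ i))
  runWord-s0^ (suc j) m i = begin
    runLetter s0 (runWord (replicate j s0) (m , i)) ≡⟨ cong (runLetter s0) (runWord-s0^ j m i) ⟩
    (m , suc (toℕ (i ⊕ + j)) mod k)                 ≡⟨ cong (m ,_) (suc-mod≡⊕1 (i ⊕ + j)) ⟩
    (m , i ⊕ + j ⊕ 1ℤ)                              ≡⟨ cong (m ,_) (⊕-assoc i (+ j) 1ℤ) ⟩
    (m , i ⊕ (+ j + 1ℤ))                            ≡⟨ cong (λ s → m , i ⊕ s) (trans (sym (pos-+ j 1)) (cong +_ (ℕ.+-comm j 1))) ⟩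
    (m , i ⊕ + suc j)                               ∎
    where open ≡-Reasoning

  runWord-s0⁻^ : ∀ j m i → runWord (replicate j s0⁻) (m , i) ≡ (m , i ⊕ - + j)
  runWord-s0⁻^ zero    m i = cong (m ,_) (sym (⊕-identityʳ i))
  runWord-s0⁻^ (suc j) m i = begin
    runLetter s0⁻ (runWord (replicate j s0⁻) (m , i)) ≡⟨ cong (runLetter s0⁻) (runWord-s0⁻^ j m i) ⟩
    (m , (toℕ (i ⊕ - + j) ℕ.+ (k ℕ.∸ 1)) mod k)       ≡⟨ cong (m ,_) (∸-mod≡⊕neg (i ⊕ - + j) 1 (ℕ.s≤s ℕ.z≤n)) ⟩
    (m , i ⊕ - + j ⊕ -1ℤ)                             ≡⟨ cong (m ,_) (⊕-assoc i (- + j) -1ℤ) ⟩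
    (m , i ⊕ (- + j + -1ℤ))                           ≡⟨ cong (λ s → m , i ⊕ s) (negate-suc j) ⟩
    (m , i ⊕ - + suc j)                               ∎
    where
    open ≡-Reasoning
    negate-suc : ∀ j → - + j + -1ℤ ≡ - + suc j
    negate-suc j = trans (sym (neg-distrib-+ (+ j) 1ℤ)) (cong -_ (trans (sym (pos-+ j 1)) (cong +_ (ℕ.+-comm j 1))))

  columnWord : Fin k → List Letter
  columnWord j = replicate (toℕ j) s0 ++ s0⁻ ∷ s1⁻ ∷ replicate (toℕ j) s0⁻

  columnWord-realises : ∀ j → columnWord j Realises (λ c → C c j)
  columnWord-realises j (m , i) = begin
    runWord (columnWord j) (m , i)
      ≡⟨ runWord-++ (replicate (toℕ j) s0) (s0⁻ ∷ s1⁻ ∷ replicate (toℕ j) s0⁻) (m , i) ⟩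
    runWord (replicate (toℕ j) s0) (runLetter s0⁻ (runLetter s1⁻ (runWord (replicate (toℕ j) s0⁻) (m , i))))
      ≡⟨ cong (λ p → runWord (replicate (toℕ j) s0) (runLetter s0⁻ (runLetter s1⁻ p))) (runWord-s0⁻^ (toℕ j) m i) ⟩
    runWord (replicate (toℕ j) s0) (runLetter s0⁻ (runLetter s1⁻ (m , i′)))
      ≡⟨ cong (runWord (replicate (toℕ j) s0)) (cong₂ _,_ translation rotation) ⟩
    runWord (replicate (toℕ j) s0) (residue n (+ toℕ m + C i′ zero) , i′)
      ≡⟨ runWord-s0^ (toℕ j) _ i′ ⟩
    (residue n (+ toℕ m + C i′ zero) , i′ ⊕ + toℕ j)
      ≡⟨ cong₂ (λ e c → residue n (+ toℕ m + e) , c) (trans (C-column₀ i′) (sym (C-index i j))) (⊕-inverseˡ i (+ toℕ j)) ⟩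
    translate (λ c → C c j) (m , i) ∎
    where
    open ≡-Reasoning
    i′ = i ⊕ - + toℕ j
    translation : (toℕ m ℕ.+ a i′) mod n ≡ residue n (+ toℕ m + C i′ zero)
    translation = trans (mod≡residue n (toℕ m ℕ.+ a i′))
      (cong (residue n) (trans (pos-+ (toℕ m) (a i′)) (cong (_+_ (+ toℕ m)) (sym (C-column₀ i′)))))
    rotation : (toℕ (suc (toℕ i′) mod k) ℕ.+ (k ℕ.∸ 1)) mod k ≡ i′
    rotation = trans (∸-mod≡⊕neg (suc (toℕ i′) mod k) 1 (ℕ.s≤s ℕ.z≤n))
                     (trans (cong (_⊕ -1ℤ) (suc-mod≡⊕1 i′)) (⊕-inverseʳ i′ 1ℤ))

  invertWord-realises : ∀ w u → w Realises u → invertWord w Realises (λ c → - u c)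
  invertWord-realises w u w≗u p = begin
    runWord (invertWord w) p
      ≡⟨ cong (runWord (invertWord w)) (trans (translate-translate u (λ c → - u c) p) (translate-zero (λ c → +-inverseʳ (u c)) p)) ⟨
    runWord (invertWord w) (translate u (translate (λ c → - u c) p))
      ≡⟨ cong (runWord (invertWord w)) (w≗u (translate (λ c → - u c) p)) ⟨
    runWord (invertWord w) (runWord w (translate (λ c → - u c) p))
      ≡⟨ runWord-inverse w (translate (λ c → - u c) p) ⟩
    translate (λ c → - u c) p ∎
    where open ≡-Reasoning

  power : ℕ → List Letter → List Letter
  power q w = concat (replicate q w)

  power-realises : ∀ q w u → w Realises u → power q w Realises (λ c → + q * u c)
  power-realises zero    w u w≗u p = sym (translate-zero (λ c → refl) p)
  power-realises (suc q) w u w≗u p = begin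
    runWord (w ++ power q w) p                     ≡⟨ runWord-++ w (power q w) p ⟩
    runWord w (runWord (power q w) p)              ≡⟨ w≗u (runWord (power q w) p) ⟩
    translate u (runWord (power q w) p)            ≡⟨ cong (translate u) (power-realises q w u w≗u p) ⟩
    translate u (translate (λ c → + q * u c) p)    ≡⟨ translate-translate u (λ c → + q * u c) p ⟩
    translate (λ c → u c + + q * u c) p            ≡⟨ translate-cong (λ c → suc-* q (u c)) p ⟩
    translate (λ c → + suc q * u c) p              ∎
    where
    open ≡-Reasoning
    suc-* : ∀ q x → x + + q * x ≡ + suc q * x
    suc-* q x = trans (cong (_+ + q * x) (sym (*-identityˡ x)))
                      (trans (sym (*-distribʳ-+ x 1ℤ (+ q))) (cong (_* x) (sym (pos-+ 1 q))))

  powerℤ : ℤ → List Letter → List Letter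
  powerℤ (+ q)      w = power q w
  powerℤ -[1+ q ]   w = invertWord (power (suc q) w)

  powerℤ-realises : ∀ z w u → w Realises u → powerℤ z w Realises (λ c → z * u c)
  powerℤ-realises (+ q)    w u w≗u = power-realises q w u w≗u
  powerℤ-realises -[1+ q ] w u w≗u p =
    trans (invertWord-realises (power (suc q) w) (λ c → + suc q * u c) (power-realises (suc q) w u w≗u) p)
          (translate-cong (λ c → neg-distribˡ-* (+ suc q) (u c)) p)

  concat-realises : ∀ {m} (f : Fin m → List Letter) (u : Fin m → Vec) → (∀ j → f j Realises u j) →
    concat (tabulate f) Realises (λ c → sumℤ (λ j → u j c))
  concat-realises {zero}  f u f≗u p = sym (translate-zero (λ c → refl) p)
  concat-realises {suc m} f u f≗u p = begin
    runWord (f zero ++ concat (tabulate (f ∘ suc))) p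
      ≡⟨ runWord-++ (f zero) (concat (tabulate (f ∘ suc))) p ⟩
    runWord (f zero) (runWord (concat (tabulate (f ∘ suc))) p)
      ≡⟨ f≗u zero _ ⟩
    translate (u zero) (runWord (concat (tabulate (f ∘ suc))) p)
      ≡⟨ cong (translate (u zero)) (concat-realises (f ∘ suc) (u ∘ suc) (f≗u ∘ suc) p) ⟩
    translate (u zero) (translate (λ c → sumℤ (λ j → u (suc j) c)) p)
      ≡⟨ translate-translate (u zero) (λ c → sumℤ (λ j → u (suc j) c)) p ⟩
    translate (λ c → sumℤ (λ j → u j c)) p ∎
    where open ≡-Reasoning

  -- Writing x = V y, the translation by embed x = C y is a product of powers of column translations.
  wordFor : G → List Letter
  wordFor (x , s) = concat (tabulate (λ j → powerℤ ((V⁻¹ *ᵛ x) j) (columnWord j))) ++ replicate (s ℤ.%ℕ k) s0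

  runWord-wordFor : ∀ g → runWord (wordFor g) ≗ perm g
  runWord-wordFor (x , s) (m , i) = begin
    runWord (translations ++ replicate (s ℤ.%ℕ k) s0) (m , i)
      ≡⟨ runWord-++ translations (replicate (s ℤ.%ℕ k) s0) (m , i) ⟩
    runWord translations (runWord (replicate (s ℤ.%ℕ k) s0) (m , i))
      ≡⟨ cong (runWord translations) (runWord-s0^ (s ℤ.%ℕ k) m i) ⟩
    runWord translations (m , i ⊕ + (s ℤ.%ℕ k))
      ≡⟨ translations-realise (m , i ⊕ + (s ℤ.%ℕ k)) ⟩
    translate (λ c → sumℤ (λ j → y j * C c j)) (m , i ⊕ + (s ℤ.%ℕ k))
      ≡⟨ cong₂ (λ e c → residue n (+ toℕ m + e) , c) (trans (sum-columns≡embed (i ⊕ + (s ℤ.%ℕ k))) (cong (embed x) rotation)) rotation ⟩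
    perm (x , s) (m , i) ∎
    where
    open ≡-Reasoning
    y = V⁻¹ *ᵛ x
    translations = concat (tabulate (λ j → powerℤ (y j) (columnWord j)))
    translations-realise : translations Realises (λ c → sumℤ (λ j → y j * C c j))
    translations-realise = concat-realises (λ j → powerℤ (y j) (columnWord j)) (λ j c → y j * C c j)
                                           (λ j → powerℤ-realises (y j) (columnWord j) (λ c → C c j) (columnWord-realises j))
    sum-columns≡embed : ∀ c → sumℤ (λ j → y j * C c j) ≡ embed x c
    sum-columns≡embed c = trans (sumℤ-cong (λ j → *-comm (y j) (C c j)))
                                (trans (sym (embed-V y c)) (*ᵛ-cong W (V*V⁻¹ x) c))
    rotation : i ⊕ + (s ℤ.%ℕ k) ≡ i ⊕ s
    rotation = ⊕-cong i (%ℕ≈ s)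

  perm-∙-inverse : ∀ g p → perm g (perm (g ⁻¹) p) ≡ p
  perm-∙-inverse (x , s) p = begin
    perm (x , s) (perm ((x , s) ⁻¹) p) ≡⟨ perm-∙ (x , s) ((x , s) ⁻¹) p ⟨
    perm ((x , s) ∙ (x , s) ⁻¹) p      ≡⟨ perm-trivial (proj₁ ((x , s) ∙ (x , s) ⁻¹)) (s + - s)
                                                       (≈-reflexive ∘ embed-cancel) (≈-reflexive (+-inverseʳ s)) p ⟩
    p                                  ∎
    where
    open ≡-Reasoning
    embed-cancel : ∀ c → embed (proj₁ ((x , s) ∙ (x , s) ⁻¹)) c ≡ 0ℤ
    embed-cancel c = begin
      embed (proj₁ ((x , s) ∙ (x , s) ⁻¹)) c                    ≡⟨ embed-∙ x s (act (- s) (λ l → - x l)) (- s) c ⟩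
      embed x c + embed (act (- s) (λ l → - x l)) (c ⊕ - s)     ≡⟨ cong (_+_ (embed x c)) (embed-act (- s) (λ l → - x l) (c ⊕ - s)) ⟩
      embed x c + embed (λ l → - x l) (c ⊕ - s ⊕ - - s)         ≡⟨ cong (λ i → embed x c + embed (λ l → - x l) i)
                                                                        (trans (cong (c ⊕ - s ⊕_) (neg-involutive s)) (⊕-inverseˡ c s)) ⟩
      embed x c + embed (λ l → - x l) c                         ≡⟨ cong (_+_ (embed x c)) (embed-neg x c) ⟩
      embed x c - embed x c                                     ≡⟨ +-inverseʳ (embed x c) ⟩
      0ℤ                                                        ∎

  evaluate-cong : ∀ w v → runWord w ≗ runWord v → evaluate w ≈G evaluate v
  evaluate-cong w v w≗v = perm-faithful (evaluate w) (evaluate v) λ p →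
    trans (perm-evaluate w p) (trans (w≗v p) (sym (perm-evaluate v p)))

  evaluate-++ : ∀ w v → evaluate (w ++ v) ≈G evaluate w ∙ evaluate v
  evaluate-++ w v = perm-faithful (evaluate (w ++ v)) (evaluate w ∙ evaluate v) λ p → begin
    perm (evaluate (w ++ v)) p               ≡⟨ perm-evaluate (w ++ v) p ⟩
    runWord (w ++ v) p                       ≡⟨ runWord-++ w v p ⟩
    runWord w (runWord v p)                  ≡⟨ cong (runWord w) (perm-evaluate v p) ⟨
    runWord w (perm (evaluate v) p)          ≡⟨ perm-evaluate w (perm (evaluate v) p) ⟨
    perm (evaluate w) (perm (evaluate v) p)  ≡⟨ perm-∙ (evaluate w) (evaluate v) p ⟨
    perm (evaluate w ∙ evaluate v) p         ∎
    where open ≡-Reasoning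

  evaluate-invertWord : ∀ w → evaluate (invertWord w) ≈G evaluate w ⁻¹
  evaluate-invertWord w = perm-faithful (evaluate (invertWord w)) (evaluate w ⁻¹) λ p → begin
    perm (evaluate (invertWord w)) p                                  ≡⟨ perm-evaluate (invertWord w) p ⟩
    runWord (invertWord w) p                                          ≡⟨ cong (runWord (invertWord w)) (perm-∙-inverse (evaluate w) p) ⟨
    runWord (invertWord w) (perm (evaluate w) (perm (evaluate w ⁻¹) p)) ≡⟨ cong (runWord (invertWord w)) (perm-evaluate w (perm (evaluate w ⁻¹) p)) ⟩
    runWord (invertWord w) (runWord w (perm (evaluate w ⁻¹) p))       ≡⟨ runWord-inverse w (perm (evaluate w ⁻¹) p) ⟩
    perm (evaluate w ⁻¹) p                                            ∎
    where open ≡-Reasoning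

  evaluate-injective : ∀ w v → evaluate w ≈G evaluate v → runWord w ≗ runWord v
  evaluate-injective w v w≈v p =
    trans (sym (perm-evaluate w p)) (trans (perm-cong (evaluate w) (evaluate v) w≈v p) (perm-evaluate v p))

  evaluate-isGroupIsomorphism : GroupMorphisms.IsGroupIsomorphism (Monodromy k n a) (Semidirect k δs act) evaluate
  evaluate-isGroupIsomorphism = record
    { isGroupMonomorphism = record
      { isGroupHomomorphism = record
        { isMonoidHomomorphism = record
          { isMagmaHomomorphism = record
            { isRelHomomorphism = record { cong = λ {w} {v} → evaluate-cong w v }
            ; homo = evaluate-++
            }
          ; ε-homo = (λ l → ≈⇒≡[mod] (≈-refl {x = 0ℤ})) , ≈⇒≡[mod] (≈-refl {x = 0ℤ})
          }
        ; ⁻¹-homo = evaluate-invertWord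
        }
      ; injective = λ {w} {v} → evaluate-injective w v
      }
    ; surjective = λ g → wordFor g , λ {w} w≈wordFor → perm-faithful (evaluate w) g λ p →
        trans (perm-evaluate w p) (trans (w≈wordFor p) (runWord-wordFor g p))
    }

theorem2 : (k n : ℕ) {{_ : NonZero k}} {{_ : NonZero n}} → 3 ≤ k →
    (a : Fin k → ℕ) → IsPolygon k n a →
    (U V : Matrix k k) (d : Fin k → ℕ) → IsSNF (circulant k a) U d V →
    Σ (ℤ → Vecℤ k (δ k n d) → Vecℤ k (δ k n d)) (λ act →
      IsCkAction k (δ k n d) act × (Monodromy k n a ≅ Semidirect k (δ k n d) act))
theorem2 (suc (suc k₂)) n (s≤s (s≤s _)) a _ U V d snf =
  act , act-isCkAction , evaluate , evaluate-isGroupIsomorphism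
  where open Realisation k₂ n a U V d snf
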